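{- Let $C$ be a cycle of even length in a graph, and let $P_1,P_2$ be two vertex-disjoint bridges of $C$ that are paths and both have even span on $C$. Let $R$ be an adjustable $(x,y)$-path with $x\in V(P_1)\setminus V(C)$, $y\in V(P_2)\setminus V(C)$, all vertices of $R$ other than $x,y$ lying outside $V(P_1)\cup V(P_2)$, and such that $C$ and $R$ are vertex-disjoint. Then $C\cup P_1\cup P_2\cup R$ contains a cycle whose length is divisible by $4$.
   Context: Graphs are finite and simple; lengths count edges. A path $P$ from $x$ to $y$ is a bridge of the cycle $C$ if $P$ is nontrivial, $P$ and $C$ are edge-disjoint and $V(P)\cap V(C)=\{x,y\}$. For $x,y\in V(C)$ and a fixed orientation of $C$, $C[x,y]$ is the path on $C$ from $x$ to $y$ along the orientation; the span of a bridge with end-vertices $x,y$ is $\min\{|C[x,y]|,|C[y,x]|\}$. An adjustable $(a,b)$-path is a graph consisting of an odd cycle $D$, a path $Q_1$ from $a$ to a vertex of $D$ having no other vertex on $D$, and a path $Q_2$ from a vertex of $D$ to $b$ having no other vertex on $D$, with $V(Q_1)\cap V(Q_2)=\emptyset$ ($Q_1$, $Q_2$ may be trivial). -}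

module Defs where

open import Data.Nat using (ℕ; _≤_; _∸_; _⊓_; ∣_-_∣)
open import Data.Nat.Divisibility using (_∣_)
open import Data.Fin using (Fin; toℕ)
open import Data.List using (List; []; _∷_; length; _++_; take; head; last; lookup)
open import Data.List.Membership.Propositional using (_∈_; _∉_)
open import Data.List.Relation.Unary.Unique.Propositional using (Unique)
open import Data.List.Relation.Unary.Linked using (Linked)
open import Data.Maybe using (just)
open import Data.Product using (Σ; ∃; _×_)
open import Data.Sum using (_⊎_)
open import Relation.Nullary using (¬_)
open import Relation.Binary.PropositionalEquality using (_≡_)

record Graph (n : ℕ) : Set₁ where
  field
    Adj    : Fin n → Fin n → Set
    sym    : ∀ {u v} → Adj u v → Adj v u
    irrefl : ∀ v → ¬ Adj v v

open Graph public

data Consec {A : Set} : List A → A → A → Set where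
  here  : ∀ {u v xs} → Consec (u ∷ v ∷ xs) u v
  there : ∀ {w u v xs} → Consec xs u v → Consec (w ∷ xs) u v

module _ {n : ℕ} where

  V : Set
  V = Fin n

  PEdge : List V → V → V → Set
  PEdge P u v = Consec P u v ⊎ Consec P v u

  close : List V → List V
  close c = c ++ take 1 c

  CEdge : List V → V → V → Set
  CEdge c u v = PEdge (close c) u v

  -- A path in G from a to b (vertex sequence, distinct vertices). Length = length P ∸ 1.
  IsPath : Graph n → List V → V → V → Set
  IsPath G P a b = Unique P × Linked (Adj G) P × head P ≡ just a × last P ≡ just b

  -- A cycle in G: at least 3 distinct vertices, cyclically adjacent. Length = length c.
  IsCycle : Graph n → List V → Set
  IsCycle G c = 3 ≤ length c × Unique c × Linked (Adj G) (close c)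

  Bridge : Graph n → List V → List V → V → V → Set
  Bridge G C P a b =
    IsPath G P a b × 1 ≤ length P ∸ 1
    × (∀ u v → PEdge P u v → ¬ CEdge C u v)
    × a ∈ C × b ∈ C
    × (∀ v → v ∈ P → v ∈ C → v ≡ a ⊎ v ≡ b)

  -- span of a bridge with end-vertices a, b on C (orientation = list order):
  -- with a at position i and b at position j, |C[a,b]| and |C[b,a]| are
  -- d and |C| - d (in some order) where d = |i - j|.
  Span : List V → V → V → ℕ → Set
  Span C a b s = Σ (Fin (length C)) λ i → Σ (Fin (length C)) λ j →
    lookup C i ≡ a × lookup C j ≡ b ×
    s ≡ (∣ toℕ i - toℕ j ∣ ⊓ (length C ∸ ∣ toℕ i - toℕ j ∣))

  EvenSpan : List V → V → V → Set
  EvenSpan C a b = ∃ λ s → Span C a b s × 2 ∣ s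

  -- Adjustable (x,y)-path consisting of odd cycle D and paths Q1, Q2.
  IsAdjustable : Graph n → List V → List V → List V → V → V → Set
  IsAdjustable G D Q1 Q2 x y =
    IsCycle G D × ¬ (2 ∣ length D)
    × (∃ λ d1 → IsPath G Q1 x d1 × d1 ∈ D × (∀ v → v ∈ Q1 → v ∈ D → v ≡ d1))
    × (∃ λ d2 → IsPath G Q2 d2 y × d2 ∈ D × (∀ v → v ∈ Q2 → v ∈ D → v ≡ d2))
    × (∀ v → v ∈ Q1 → v ∉ Q2)

  RVert : List V → List V → List V → V → Set
  RVert D Q1 Q2 v = v ∈ D ⊎ v ∈ Q1 ⊎ v ∈ Q2

  REdge : List V → List V → List V → V → V → Set
  REdge D Q1 Q2 u v = CEdge D u v ⊎ PEdge Q1 u v ⊎ PEdge Q2 u v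

{-# OPTIONS --safe #-}
module Submission where

-- If 4 divides |C| we are done, so let |C| ≡ 2 (mod 4). Each case below then produces two cycles of
-- lengths a, b with a even and a + b ≡ 2 (mod 4), so that one of them is divisible by 4. As |C| and
-- the spans are even, both arcs of C between the ends of a bridge are even, so a bridge of even length
-- closes up with either of them. Otherwise both bridges are odd. Cutting P₁ at x and P₂ at y, a segment
-- of P₁, an arc of C, a segment of P₂ and an x–y path in R form a cycle, and R has x–y paths of both
-- parities (around the odd cycle D either way). If ends of P₁ and P₂ are at even distance on C, the two
-- arcs between them do it. If they are at odd distance and the bridges do not cross, the four pairs of
-- ends give lengths u, v, w, z with u + w odd and u + v ≡ w + z (mod 4), and a suitable x–y path makes
-- one of the pairs {u, v}, {w, z} work. If the bridges cross, P₁ ∪ P₂ and two opposite arcs of C form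
-- two cycles whose lengths sum to 2|P₁| + 2|P₂| + |C| ≡ 2 (mod 4).

open import Defs
open import Data.Nat using (ℕ; zero; suc; _+_; _*_; _∸_; _≤_; _<_; _⊓_; ∣_-_∣; s≤s; z≤n; parity)
open import Data.Nat.Properties
  using ( suc-injective; +-suc; +-comm; +-assoc; +-identityʳ; +-cancelˡ-≡; +-mono-≤; ≤-refl; ≤-trans; ≤-reflexive
        ; ≤-pred; <-trans; <-≤-trans; ≤-<-trans; <-cmp; <⇒≤; <⇒≢; <⇒≱; m≤m+n; m<m+n; m+[n∸m]≡n; m∸n+n≡m
        ; m∸n≤m; ⊓-sel; m≤n⇒∣m-n∣≡n∸m; ∣-∣-comm )
open import Data.Nat.Divisibility using (_∣_; _∤_; divides; ∣m∣n⇒∣m+n; ∣m+n∣m⇒∣n)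
open import Data.Nat.Tactic.RingSolver using (solve-∀)
open import Data.Parity.Base as ℙ using (0ℙ; 1ℙ)
open import Data.Parity.Properties using (+-homo-+; p+p≡0ℙ) renaming (+-comm to ℙ+-comm; +-identityʳ to ℙ+-identityʳ)
open import Data.Fin using (Fin; toℕ)
open import Data.Fin.Properties using (toℕ<n; toℕ-injective)
open import Data.List using (List; []; _∷_; [_]; _++_; _∷ʳ_; head; last; length; reverse; lookup; take)
open import Data.List.Properties
  using (++-assoc; ++-identityʳ; unfold-reverse; length-++; length-reverse; ∷-injective)
open import Data.List.Membership.Propositional using (_∈_; _∉_)
open import Data.List.Membership.Propositional.Properties using (∈-++⁺ˡ; ∈-++⁺ʳ; ∈-++⁻; ∈-∃++)
open import Data.List.Relation.Unary.Any using (here; there)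
import Data.List.Relation.Unary.Any.Properties as Any
open import Data.List.Relation.Unary.All as All using ([]; _∷_)
open import Data.List.Relation.Unary.Unique.Propositional using (Unique; []; _∷_)
import Data.List.Relation.Unary.Unique.Propositional.Properties as Unique
open import Data.List.Relation.Binary.Disjoint.Propositional using (Disjoint)
open import Data.List.Relation.Unary.Linked using (Linked; []; [-]; _∷_)
open import Data.Maybe using (just)
open import Data.Product using (Σ; ∃; ∃₂; _×_; _,_; proj₁; proj₂)
open import Data.Sum using (_⊎_; inj₁; inj₂; swap) renaming (map to ⊎-map)
open import Data.Empty using (⊥-elim)
open import Function using (_∘_)
open import Relation.Nullary using (¬_)
open import Relation.Unary using (_⊆_; _∪_; _∩_)
open import Relation.Binary.Definitions using (tri<; tri≈; tri>)
open import Relation.Binary.PropositionalEquality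
  using (_≡_; _≢_; refl; trans; cong; cong₂; subst; ≢-sym; module ≡-Reasoning) renaming (sym to ≡-sym)

-- Lists: consecutive pairs, reversal and positions

module _ {A : Set} where

  Consec-++⁺ˡ : ∀ {xs ys : List A} {u v} → Consec xs u v → Consec (xs ++ ys) u v
  Consec-++⁺ˡ here      = here
  Consec-++⁺ˡ (there c) = there (Consec-++⁺ˡ c)

  Consec-++⁺ʳ : ∀ (xs : List A) {ys u v} → Consec ys u v → Consec (xs ++ ys) u v
  Consec-++⁺ʳ []       c = c
  Consec-++⁺ʳ (x ∷ xs) c = there (Consec-++⁺ʳ xs c)

  Consec-∷ʳ : ∀ (xs : List A) {u v} → last xs ≡ just u → Consec (xs ∷ʳ v) u v
  Consec-∷ʳ (x ∷ [])     refl = here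
  Consec-∷ʳ (x ∷ y ∷ xs) eq   = there (Consec-∷ʳ (y ∷ xs) eq)

  Consec-++⁻ : ∀ (xs : List A) {ys u v} → Consec (xs ++ ys) u v →
               Consec xs u v ⊎ Consec ys u v ⊎ (last xs ≡ just u × head ys ≡ just v)
  Consec-++⁻ []           c              = inj₂ (inj₁ c)
  Consec-++⁻ (x ∷ [])     {_ ∷ _} here   = inj₂ (inj₂ (refl , refl))
  Consec-++⁻ (x ∷ [])     (there c)      = inj₂ (inj₁ c)
  Consec-++⁻ (x ∷ y ∷ xs) here           = inj₁ here
  Consec-++⁻ (x ∷ y ∷ xs) (there c) with Consec-++⁻ (y ∷ xs) c
  ... | inj₁ c′ = inj₁ (there c′)
  ... | inj₂ r  = inj₂ r

  Linked⇒Consec : ∀ {R : A → A → Set} {xs u v} → Linked R xs → Consec xs u v → R u v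
  Linked⇒Consec (r ∷ _)  here      = r
  Linked⇒Consec (_ ∷ rs) (there c) = Linked⇒Consec rs c

  Consec⇒Linked : ∀ {R : A → A → Set} (xs : List A) → (∀ {u v} → Consec xs u v → R u v) → Linked R xs
  Consec⇒Linked []           f = []
  Consec⇒Linked (x ∷ [])     f = [-]
  Consec⇒Linked (x ∷ y ∷ xs) f = f here ∷ Consec⇒Linked (y ∷ xs) (f ∘ there)

  last-∷ʳ : ∀ (xs : List A) x → last (xs ∷ʳ x) ≡ just x
  last-∷ʳ []           x = refl
  last-∷ʳ (_ ∷ [])     x = refl
  last-∷ʳ (_ ∷ y ∷ xs) x = last-∷ʳ (y ∷ xs) x

  last-++-∷ : ∀ (xs : List A) y ys → last (xs ++ y ∷ ys) ≡ last (y ∷ ys)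
  last-++-∷ []           y ys = refl
  last-++-∷ (_ ∷ [])     y ys = refl
  last-++-∷ (_ ∷ x ∷ xs) y ys = last-++-∷ (x ∷ xs) y ys

  head-++⁺ : ∀ {xs ys : List A} {a} → head xs ≡ just a → head (xs ++ ys) ≡ just a
  head-++⁺ {_ ∷ _} refl = refl

  head⇒∈ : ∀ {xs : List A} {w} → head xs ≡ just w → w ∈ xs
  head⇒∈ {_ ∷ _} refl = here refl

  last⇒∈ : ∀ {xs : List A} {w} → last xs ≡ just w → w ∈ xs
  last⇒∈ {_ ∷ []}     refl = here refl
  last⇒∈ {_ ∷ y ∷ xs} eq   = there (last⇒∈ {y ∷ xs} eq)

  last⇒∷ʳ : ∀ (xs : List A) {w} → last xs ≡ just w → ∃ λ ys → xs ≡ ys ∷ʳ w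
  last⇒∷ʳ (_ ∷ [])     refl = [] , refl
  last⇒∷ʳ (x ∷ y ∷ xs) eq   with last⇒∷ʳ (y ∷ xs) eq
  ... | ys , eq′ = x ∷ ys , cong (x ∷_) eq′

  last⇒head-reverse : ∀ (xs : List A) {b} → last xs ≡ just b → head (reverse xs) ≡ just b
  last⇒head-reverse (x ∷ [])     refl = refl
  last⇒head-reverse (x ∷ y ∷ xs) eq =
    trans (cong head (unfold-reverse x (y ∷ xs))) (head-++⁺ (last⇒head-reverse (y ∷ xs) eq))

  last-reverse : ∀ (x : A) xs → last (reverse (x ∷ xs)) ≡ just x
  last-reverse x xs rewrite unfold-reverse x xs = last-∷ʳ (reverse xs) x

  Consec-reverse⁻ : ∀ (xs : List A) {u v} → Consec (reverse xs) u v → Consec xs v u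
  Consec-reverse⁻ (x ∷ xs) c rewrite unfold-reverse x xs with Consec-++⁻ (reverse xs) c
  ... | inj₁ c′                  = there (Consec-reverse⁻ xs c′)
  ... | inj₂ (inj₁ (there ()))
  ... | inj₂ (inj₂ (eq , refl)) = Consec-head xs (last-reverse⇒head xs eq)
    where
      last-reverse⇒head : ∀ (ys : List A) {u} → last (reverse ys) ≡ just u → head ys ≡ just u
      last-reverse⇒head (y ∷ ys) eq = trans (≡-sym (last-reverse y ys)) eq
      Consec-head : ∀ (ys : List A) {u} → head ys ≡ just u → Consec (x ∷ ys) x u
      Consec-head (_ ∷ _) refl = here

  Unique-∷ : ∀ {x : A} {xs} → x ∉ xs → Unique xs → Unique (x ∷ xs)
  Unique-∷ x∉ u = All.tabulate (λ { y∈ refl → x∉ y∈ }) ∷ u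

  Unique-++⁻ : ∀ (xs : List A) {ys} → Unique (xs ++ ys) → Unique xs × Unique ys × Disjoint xs ys
  Unique-++⁻ []       u       = [] , u , λ ()
  Unique-++⁻ (x ∷ xs) u@(_ ∷ u′) with Unique-++⁻ xs u′
  ... | uxs , uys , disj =
    Unique-∷ (x∉ ∘ ∈-++⁺ˡ) uxs , uys ,
    λ { (here refl , y∈) → x∉ (∈-++⁺ʳ xs y∈) ; (there y∈ , y∈′) → disj (y∈ , y∈′) }
    where x∉ = Unique.Unique[x∷xs]⇒x∉xs u

  Unique-swap : ∀ (xs : List A) {ys} → Unique (xs ++ ys) → Unique (ys ++ xs)
  Unique-swap xs u with Unique-++⁻ xs u
  ... | uxs , uys , disj = Unique.++⁺ uys uxs (λ (p , q) → disj (q , p))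

  Unique-reverse : ∀ {xs : List A} → Unique xs → Unique (reverse xs)
  Unique-reverse {[]}     u        = u
  Unique-reverse {x ∷ xs} u@(_ ∷ u′) rewrite unfold-reverse x xs =
    Unique.++⁺ (Unique-reverse u′) ([] ∷ [])
      (λ { (y∈ , here refl) → Unique.Unique[x∷xs]⇒x∉xs u (Any.reverse⁻ y∈) })

  Unique-∷⁻ : ∀ {x : A} {xs} → Unique (x ∷ xs) → Unique xs
  Unique-∷⁻ (_ ∷ u) = u

  At : List A → ℕ → A → Set
  At K i v = ∃₂ λ X Y → K ≡ X ++ v ∷ Y × length X ≡ i

  lookup⇒At : ∀ (K : List A) i → At K (toℕ i) (lookup K i)
  lookup⇒At (x ∷ K) Fin.zero    = [] , K , refl , refl
  lookup⇒At (x ∷ K) (Fin.suc i) with X , Y , eq , len ← lookup⇒At K i = x ∷ X , Y , cong (x ∷_) eq , cong suc len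

  At⇒∈ : ∀ {K : List A} {i v} → At K i v → v ∈ K
  At⇒∈ (X , _ , refl , _) = ∈-++⁺ʳ X (here refl)

  ∈⇒At : ∀ {K : List A} {v} → v ∈ K → ∃ λ i → At K i v
  ∈⇒At {x ∷ K} (here refl) = 0 , [] , K , refl , refl
  ∈⇒At {x ∷ K} (there v∈) with i , X , Y , eq , len ← ∈⇒At v∈ = suc i , x ∷ X , Y , cong (x ∷_) eq , cong suc len

  ++-∷-split : ∀ (X X′ : List A) {u v Y Y′} → X ++ u ∷ Y ≡ X′ ++ v ∷ Y′ → length X < length X′ →
               ∃ λ B → Y ≡ B ++ v ∷ Y′ × length X + suc (length B) ≡ length X′
  ++-∷-split []      (_ ∷ X′) refl _ = X′ , refl , refl
  ++-∷-split (_ ∷ X) (_ ∷ X′) eq (s≤s lt) with B , eq′ , len ← ++-∷-split X X′ (proj₂ (∷-injective eq)) lt =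
    B , eq′ , cong suc len

  At-functional : ∀ {K : List A} {i u v} → At K i u → At K i v → u ≡ v
  At-functional (X , Y , refl , refl) (X′ , Y′ , eq , len) = go X X′ eq (≡-sym len)
    where
      go : ∀ (X X′ : List A) {u v Y Y′} → X ++ u ∷ Y ≡ X′ ++ v ∷ Y′ → length X ≡ length X′ → u ≡ v
      go []      []       refl _   = refl
      go (_ ∷ X) (_ ∷ X′) eq   len = go X X′ (proj₂ (∷-injective eq)) (cong pred len)
        where pred : ℕ → ℕ
              pred zero = zero
              pred (suc k) = k

  At-injective : ∀ {K : List A} {i j v} → Unique K → At K i v → At K j v → i ≡ j
  At-injective {i = i} {j} u (X , Y , refl , refl) (X′ , Y′ , eq , refl) with <-cmp (length X) (length X′)
  ... | tri≈ _ i≡j _ = i≡j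
  ... | tri< i<j _ _ with B , refl , _ ← ++-∷-split X X′ eq i<j =
    ⊥-elim (Unique.Unique[x∷xs]⇒x∉xs (proj₁ (proj₂ (Unique-++⁻ X u))) (∈-++⁺ʳ B (here refl)))
  ... | tri> _ _ j<i with B , refl , _ ← ++-∷-split X′ X (≡-sym eq) j<i =
    ⊥-elim (Unique.Unique[x∷xs]⇒x∉xs (proj₁ (proj₂ (Unique-++⁻ X′ (subst Unique eq u)))) (∈-++⁺ʳ B (here refl)))

  At-infix : ∀ (X Y Z : List A) {w} → w ∈ Y →
             ∃ λ k → length X ≤ k × k < length X + length Y × At (X ++ Y ++ Z) k w
  At-infix X (y ∷ Y) Z (here refl) = length X , ≤-refl , m<m+n (length X) (s≤s z≤n) , X , Y ++ Z , refl , refl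
  At-infix X (y ∷ Y) Z (there w∈) with k , lo , hi , P , Q , eq , len ← At-infix (X ∷ʳ y) Y Z w∈ =
    k , ≤-trans (≤-trans (m≤m+n (length X) 1) (≤-reflexive (≡-sym (length-++ X)))) lo ,
    <-≤-trans hi (≤-reflexive (trans (cong (_+ length Y) (length-++ X)) (+-assoc (length X) 1 (length Y)))) ,
    P , Q , trans (≡-sym (++-assoc X [ y ] (Y ++ Z))) eq , len

  Consec-infix : ∀ (X Z : List A) {Y u v} → Consec Y u v → Consec (X ++ Y ++ Z) u v
  Consec-infix X Z c = Consec-++⁺ʳ X (Consec-++⁺ˡ c)

  Unique-infix : ∀ (X Y Z : List A) → Unique (X ++ Y ++ Z) → Unique Y
  Unique-infix X Y Z u = proj₁ (Unique-++⁻ Y (proj₁ (proj₂ (Unique-++⁻ X u))))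

  length-∷ʳ : ∀ (xs : List A) x → length (xs ∷ʳ x) ≡ suc (length xs)
  length-∷ʳ []       x = refl
  length-∷ʳ (_ ∷ xs) x = cong suc (length-∷ʳ xs x)

  ∉⇒≢ : ∀ {u v} {K : List A} → u ∉ K → v ∈ K → u ≢ v
  ∉⇒≢ u∉ v∈ refl = u∉ v∈

-- Parity and residues modulo 4

Even Odd : ℕ → Set
Even n = parity n ≡ 0ℙ
Odd  n = parity n ≡ 1ℙ

parity-+ : ∀ m n {p q} → parity m ≡ p → parity n ≡ q → parity (m + n) ≡ p ℙ.+ q
parity-+ m n refl refl = +-homo-+ m n

even-n+n : ∀ n → Even (n + n)
even-n+n n = trans (+-homo-+ n n) (p+p≡0ℙ (parity n))

even⇒2∣ : ∀ {n} → Even n → 2 ∣ n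
even⇒2∣ {0}           _ = divides 0 refl
even⇒2∣ {suc (suc n)} e with divides q eq ← even⇒2∣ {n} e = divides (suc q) (cong (λ k → suc (suc k)) eq)

2∣⇒even : ∀ {n} → 2 ∣ n → Even n
2∣⇒even (divides q refl) = even-q*2 q
  where even-q*2 : ∀ q → Even (q * 2)
        even-q*2 zero    = refl
        even-q*2 (suc q) = even-q*2 q

2∤⇒odd : ∀ {n} → 2 ∤ n → Odd n
2∤⇒odd {n} 2∤n with parity n in eq
... | 0ℙ = ⊥-elim (2∤n (even⇒2∣ eq))
... | 1ℙ = refl

odd-sum⇒even-summand : ∀ {m n} → Odd (m + n) → Even m ⊎ Even n
odd-sum⇒even-summand {m} {n} odd with parity m | parity n | trans (≡-sym (+-homo-+ m n)) odd
... | 0ℙ | _  | _ = inj₁ refl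
... | 1ℙ | 0ℙ | _ = inj₂ refl

even⇒4∣n+n : ∀ {n} → Even n → 4 ∣ n + n
even⇒4∣n+n {n} e with divides q refl ← even⇒2∣ {n} e = divides q (q*2+q*2≡q*4 q)
  where q*2+q*2≡q*4 : ∀ q → q * 2 + q * 2 ≡ q * 4
        q*2+q*2≡q*4 = solve-∀

odd⇒4∣n+n+2 : ∀ {n} → Odd n → 4 ∣ (n + n) + 2
odd⇒4∣n+n+2 {n} o = subst (4 ∣_) (1+n+1+n n) (even⇒4∣n+n {suc n} (trans (+-homo-+ 1 n) (cong ℙ._⁻¹ o)))
  where 1+n+1+n : ∀ n → suc n + suc n ≡ (n + n) + 2
        1+n+1+n = solve-∀

even⇒4∣n⊎4∣n+2 : ∀ {n} → Even n → 4 ∣ n ⊎ 4 ∣ n + 2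
even⇒4∣n⊎4∣n+2 {n} e with divides q refl ← even⇒2∣ {n} e | parity q in eq
... | 0ℙ = inj₁ (subst (4 ∣_) (q+q≡q*2 q) (even⇒4∣n+n {q} eq))
  where q+q≡q*2 : ∀ q → q + q ≡ q * 2
        q+q≡q*2 = solve-∀
... | 1ℙ = inj₂ (subst (4 ∣_) (q+q+2≡q*2+2 q) (odd⇒4∣n+n+2 {q} eq))
  where q+q+2≡q*2+2 : ∀ q → (q + q) + 2 ≡ q * 2 + 2
        q+q+2≡q*2+2 = solve-∀

even∧4∣m+n+2⇒4∣m⊎4∣n : ∀ {m n} → Even m → 4 ∣ (m + n) + 2 → 4 ∣ m ⊎ 4 ∣ n
even∧4∣m+n+2⇒4∣m⊎4∣n {m} {n} e 4∣m+n+2 with even⇒4∣n⊎4∣n+2 e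
... | inj₁ 4∣m   = inj₁ 4∣m
... | inj₂ 4∣m+2 = inj₂ (∣m+n∣m⇒∣n (subst (4 ∣_) (shift-2 m n) 4∣m+n+2) 4∣m+2)
  where shift-2 : ∀ m n → (m + n) + 2 ≡ (m + 2) + n
        shift-2 = solve-∀

gap-parity : ∀ {i d j} → i + d ≡ j → parity d ≡ parity i ℙ.+ parity j
gap-parity {i} {d} refl rewrite +-homo-+ i d = cancel (parity i) (parity d)
  where cancel : ∀ p q → q ≡ p ℙ.+ (p ℙ.+ q)
        cancel 0ℙ q  = refl
        cancel 1ℙ 0ℙ = refl
        cancel 1ℙ 1ℙ = refl

gap-parity-either : ∀ {i d j} → i + d ≡ j ⊎ j + d ≡ i → parity d ≡ parity i ℙ.+ parity j
gap-parity-either {i} {d} (inj₁ i+d≡j) = gap-parity {i} {d} i+d≡j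
gap-parity-either {i} {d} {j} (inj₂ j+d≡i) = trans (gap-parity {j} {d} j+d≡i) (ℙ+-comm (parity j) (parity i))

<∧≤⇒≢ : ∀ {a b k} → a < b → b ≤ k → k ≢ a
<∧≤⇒≢ a<b b≤k = ≢-sym (<⇒≢ (<-≤-trans a<b b≤k))

≤∧<⇒≢ : ∀ {a b k} → k ≤ a → a < b → k ≢ b
≤∧<⇒≢ k≤a a<b = <⇒≢ (≤-<-trans k≤a a<b)

even-span⇒even-gap : ∀ {i j M} → i ≤ j → j ≤ M → Even M → Even (∣ i - j ∣ ⊓ (M ∸ ∣ i - j ∣)) → Even (j ∸ i)
even-span⇒even-gap {i} {j} {M} i≤j j≤M even-M even-span rewrite m≤n⇒∣m-n∣≡n∸m i≤j
  with ⊓-sel (j ∸ i) (M ∸ (j ∸ i))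
... | inj₁ eq = subst Even eq even-span
... | inj₂ eq = trans (gap-parity {M ∸ (j ∸ i)} (m∸n+n≡m (≤-trans (m∸n≤m j i) j≤M)))
                     (cong₂ ℙ._+_ (subst Even eq even-span) even-M)

consecutive-gaps : ∀ a dab dbc dcd dad {b c d} →
                   a + dab ≡ b → b + dbc ≡ c → c + dcd ≡ d → a + dad ≡ d → (dab + dbc) + dcd ≡ dad
consecutive-gaps a dab dbc dcd dad ab bc cd ad = +-cancelˡ-≡ a _ _ (begin
  a + ((dab + dbc) + dcd)  ≡⟨ reassociate a dab dbc dcd ⟩
  ((a + dab) + dbc) + dcd  ≡⟨ cong (λ k → (k + dbc) + dcd) ab ⟩
  (_ + dbc) + dcd          ≡⟨ cong (_+ dcd) bc ⟩
  _ + dcd                  ≡⟨ cd ⟩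
  _                        ≡⟨ ad ⟨
  a + dad                  ∎)
  where open ≡-Reasoning
        reassociate : ∀ a b c d → a + ((b + c) + d) ≡ ((a + b) + c) + d
        reassociate = solve-∀

separated-gaps : ∀ a b dac dad dbc dbd {c d} →
                 a + dac ≡ c → a + dad ≡ d → b + dbc ≡ c → b + dbd ≡ d → dad + dbc ≡ dac + dbd
separated-gaps a b dac dad dbc dbd {c} {d} ac ad bc bd = +-cancelˡ-≡ (a + b) _ _ (begin
  (a + b) + (dad + dbc)   ≡⟨ interchange a b dad dbc ⟩
  (a + dad) + (b + dbc)   ≡⟨ cong₂ _+_ ad bc ⟩
  d + c                   ≡⟨ +-comm d c ⟩
  c + d                   ≡⟨ cong₂ _+_ ac bd ⟨
  (a + dac) + (b + dbd)   ≡⟨ interchange a b dac dbd ⟨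
  (a + b) + (dac + dbd)   ∎)
  where open ≡-Reasoning
        interchange : ∀ a b x y → (a + b) + (x + y) ≡ (a + x) + (b + y)
        interchange = solve-∀

nested-gaps : ∀ a b g dab dac dbd dcd {c d} →
              b + g ≡ c → a + dab ≡ b → a + dac ≡ c → b + dbd ≡ d → c + dcd ≡ d → dac + dbd ≡ (dab + dcd) + (g + g)
nested-gaps a b g dab dac dbd dcd {c} {d} bc ab ac bd cd = begin
  dac + dbd                ≡⟨ cong₂ _+_ dac≡dab+g dbd≡g+dcd ⟩
  (dab + g) + (g + dcd)    ≡⟨ rearrange dab dcd g ⟩
  (dab + dcd) + (g + g)    ∎
  where
    open ≡-Reasoning
    dac≡dab+g : dac ≡ dab + g
    dac≡dab+g = +-cancelˡ-≡ a _ _ (begin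
      a + dac        ≡⟨ ac ⟩
      c              ≡⟨ bc ⟨
      b + g          ≡⟨ cong (_+ g) ab ⟨
      (a + dab) + g  ≡⟨ +-assoc a dab g ⟩
      a + (dab + g)  ∎)
    dbd≡g+dcd : dbd ≡ g + dcd
    dbd≡g+dcd = +-cancelˡ-≡ b _ _ (begin
      b + dbd        ≡⟨ bd ⟩
      d              ≡⟨ cd ⟨
      c + dcd        ≡⟨ cong (_+ dcd) bc ⟨
      (b + g) + dcd  ≡⟨ +-assoc b g dcd ⟩
      b + (g + dcd)  ∎)
    rearrange : ∀ x y g → (x + g) + (g + y) ≡ (x + y) + (g + g)
    rearrange = solve-∀



-- Paths, and cycles closed up from paths

module Paths {n : ℕ} (G : Graph n) (E : Fin n → Fin n → Set) (E-sym : ∀ {u v} → E u v → E v u) where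

  Edge : Fin n → Fin n → Set
  Edge u v = Adj G u v × E u v

  Edge-sym : ∀ {u v} → Edge u v → Edge v u
  Edge-sym (uv , e) = sym G uv , E-sym e

  record Path (a b : Fin n) (ℓ : ℕ) (S : Fin n → Set) : Set where
    constructor mkPath
    field
      tail    : List (Fin n)
      length≡ : length tail ≡ ℓ
      unique  : Unique (a ∷ tail)
      edges   : ∀ {u v} → Consec (a ∷ tail) u v → Edge u v
      last≡   : last (a ∷ tail) ≡ just b
      inside  : ∀ {v} → v ∈ a ∷ tail → S v

  Cycle : ℕ → Set
  Cycle k = Σ (List (Fin n)) λ Z → IsCycle G Z × (∀ u v → CEdge Z u v → E u v) × length Z ≡ k

  fromList : ∀ {a b ℓ S} (zs : List (Fin n)) → head zs ≡ just a → last zs ≡ just b →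
             length zs ≡ suc ℓ → Unique zs → (∀ {u v} → Consec zs u v → Edge u v) →
             (∀ {v} → v ∈ zs → S v) → Path a b ℓ S
  fromList (z ∷ zs) refl lst len u es ss = mkPath zs (suc-injective len) u es lst ss

  mono : ∀ {a b ℓ S T} → S ⊆ T → Path a b ℓ S → Path a b ℓ T
  mono S⊆T (mkPath t len u es lst ss) = mkPath t len u es lst (S⊆T ∘ ss)

  reversePath : ∀ {a b ℓ S} → Path a b ℓ S → Path b a ℓ S
  reversePath {a} (mkPath t len u es lst ss) =
    fromList (reverse (a ∷ t)) (last⇒head-reverse (a ∷ t) lst) (last-reverse a t)
      (trans (length-reverse (a ∷ t)) (cong suc len)) (Unique-reverse u)
      (Edge-sym ∘ es ∘ Consec-reverse⁻ (a ∷ t)) (ss ∘ Any.reverse⁻)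

  loop-length≡0 : ∀ {a ℓ S} → Path a a ℓ S → ℓ ≡ 0
  loop-length≡0 (mkPath []       len _ _ _   _) = ≡-sym len
  loop-length≡0 (mkPath (y ∷ ys) _   u _ lst _) =
    ⊥-elim (Unique.Unique[x∷xs]⇒x∉xs u (last⇒∈ {xs = y ∷ ys} lst))

  1≤length : ∀ {a b ℓ S} → a ≢ b → Path a b ℓ S → 1 ≤ ℓ
  1≤length a≢b (mkPath []      refl _ _ refl _) = ⊥-elim (a≢b refl)
  1≤length _   (mkPath (_ ∷ _) refl _ _ _    _) = s≤s z≤n

  private
    join-edges : ∀ {a b} (t₁ t₂ : List (Fin n)) → last (a ∷ t₁) ≡ just b →
                 (∀ {u v} → Consec (a ∷ t₁) u v → Edge u v) → (∀ {u v} → Consec (b ∷ t₂) u v → Edge u v) →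
                 ∀ {u v} → Consec ((a ∷ t₁) ++ t₂) u v → Edge u v
    join-edges {a} t₁ t₂ lst₁ es₁ es₂ c with Consec-++⁻ (a ∷ t₁) c
    ... | inj₁ c₁ = es₁ c₁
    ... | inj₂ (inj₁ c₂) = es₂ (there c₂)
    ... | inj₂ (inj₂ (lst , hd)) with refl ← trans (≡-sym lst₁) lst | _ ∷ _ ← t₂ | refl ← hd = es₂ here

  concat : ∀ {a b c ℓ m S T} → Path a b ℓ S → Path b c m T → S ∩ T ⊆ (_≡ b) → Path a c (ℓ + m) (S ∪ T)
  concat {a} {b} {c} {ℓ} {m} {S} {T} (mkPath t₁ len₁ u₁ es₁ lst₁ ss₁)
         (mkPath t₂ len₂ u₂@(_ ∷ u₂′) es₂ lst₂ ss₂) meet =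
    fromList ((a ∷ t₁) ++ t₂) refl (last-concat t₂ lst₂) (cong suc (trans (length-++ t₁) (cong₂ _+_ len₁ len₂)))
      (Unique.++⁺ u₁ u₂′ disjoint) (join-edges t₁ t₂ lst₁ es₁ es₂) inside
    where
      last-concat : ∀ t → last (b ∷ t) ≡ just c → last ((a ∷ t₁) ++ t) ≡ just c
      last-concat []      lst = trans (cong last (++-identityʳ (a ∷ t₁))) (trans lst₁ lst)
      last-concat (y ∷ t) lst = trans (last-++-∷ (a ∷ t₁) y t) lst
      disjoint : ∀ {v} → ¬ (v ∈ a ∷ t₁ × v ∈ t₂)
      disjoint (v∈₁ , v∈₂) with refl ← meet (ss₁ v∈₁ , ss₂ (there v∈₂)) = Unique.Unique[x∷xs]⇒x∉xs u₂ v∈₂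
      inside : ∀ {v} → v ∈ (a ∷ t₁) ++ t₂ → (S ∪ T) v
      inside v∈ with ∈-++⁻ (a ∷ t₁) v∈
      ... | inj₁ v∈₁ = inj₁ (ss₁ v∈₁)
      ... | inj₂ v∈₂ = inj₂ (ss₂ (there v∈₂))

  close-cycle : ∀ {a b ℓ m S T} → Path a b ℓ S → Path b a m T → S ∩ T ⊆ (λ v → v ≡ a ⊎ v ≡ b) →
                3 ≤ ℓ + m → Cycle (ℓ + m)
  close-cycle {a} {b} {ℓ} {m} p@(mkPath t₁ len₁ u₁ es₁ lst₁ ss₁) (mkPath t₂ len₂ u₂ es₂ lst₂ ss₂) meet 3≤
    with last⇒∷ʳ (b ∷ t₂) lst₂
  ... | [] , refl with refl ← len₂ = ⊥-elim (3≰ (subst (λ k → 3 ≤ k + 0) (loop-length≡0 p) 3≤))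
    where 3≰ : ¬ 3 ≤ 0
          3≰ ()
  ... | _ ∷ ms , refl =
    Z , (subst (3 ≤_) (≡-sym length-Z) 3≤ , unique-Z , Consec⇒Linked (close Z) (proj₁ ∘ edges-Z)) ,
    (λ { u v (inj₁ c) → proj₂ (edges-Z c) ; u v (inj₂ c) → E-sym (proj₂ (edges-Z c)) }) ,
    length-Z
    where
      Z : List (Fin n)
      Z = (a ∷ t₁) ++ ms
      edges-Z : ∀ {u v} → Consec (close Z) u v → Edge u v
      edges-Z {u} {v} c =
        join-edges t₁ (ms ∷ʳ a) lst₁ es₁ es₂ (subst (λ L → Consec L u v) (++-assoc (a ∷ t₁) ms [ a ]) c)
      u-ms : Unique ms
      u-ms = proj₁ (Unique-++⁻ ms (Unique-∷⁻ u₂))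
      disjoint : ∀ {v} → ¬ (v ∈ a ∷ t₁ × v ∈ ms)
      disjoint (v∈₁ , v∈ms) with meet (ss₁ v∈₁ , ss₂ (there (∈-++⁺ˡ v∈ms)))
      ... | inj₁ refl = proj₂ (proj₂ (Unique-++⁻ ms (Unique-∷⁻ u₂))) (v∈ms , here refl)
      ... | inj₂ refl = Unique.Unique[x∷xs]⇒x∉xs u₂ (∈-++⁺ˡ v∈ms)
      unique-Z : Unique Z
      unique-Z = Unique.++⁺ u₁ u-ms disjoint
      length-Z : length Z ≡ ℓ + m
      length-Z = begin
        suc (length (t₁ ++ ms))      ≡⟨ cong suc (length-++ t₁) ⟩
        suc (length t₁ + length ms)  ≡⟨ cong (λ k → suc (k + length ms)) len₁ ⟩
        suc (ℓ + length ms)          ≡⟨ ≡-sym (+-suc ℓ (length ms)) ⟩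
        ℓ + suc (length ms)          ≡⟨ cong (ℓ +_) (≡-sym (trans (length-++ ms) (+-comm (length ms) 1))) ⟩
        ℓ + length (ms ∷ʳ a)         ≡⟨ cong (ℓ +_) len₂ ⟩
        ℓ + m                        ∎
        where open ≡-Reasoning

  split : ∀ {a b ℓ S x} (p : Path a b ℓ S) → x ∈ a ∷ Path.tail p → x ≢ a → x ≢ b →
          ∃₂ λ ℓ₁ ℓ₂ → ℓ₁ + ℓ₂ ≡ ℓ × Path x a ℓ₁ (S ∩ (_≢ b)) × Path x b ℓ₂ (S ∩ (_≢ a))
  split {a} {b} {ℓ} {S} {x} (mkPath t len u es lst ss) x∈ x≢a x≢b with ∈-∃++ x∈
  ... | [] , _ , refl = ⊥-elim (x≢a refl)
  ... | _ ∷ L , R , refl =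
    suc (length L) , length R , length-parts ,
    reversePath (mkPath (L ∷ʳ x) (trans (length-++ L) (+-comm (length L) 1)) u-prefix
                   (es ∘ Consec-prefix) (last-∷ʳ (a ∷ L) x) inside-prefix) ,
    mkPath R refl u-suffix (es ∘ Consec-++⁺ʳ (a ∷ L)) lst-suffix inside-suffix
    where
      assoc : (a ∷ L) ++ x ∷ R ≡ (a ∷ L ∷ʳ x) ++ R
      assoc = ≡-sym (++-assoc (a ∷ L) [ x ] R)
      halves : Unique (a ∷ L) × Unique (x ∷ R) × Disjoint (a ∷ L) (x ∷ R)
      halves = Unique-++⁻ (a ∷ L) u
      u-prefix : Unique (a ∷ L ∷ʳ x)
      u-prefix = proj₁ (Unique-++⁻ (a ∷ L ∷ʳ x) (subst Unique assoc u))
      u-suffix : Unique (x ∷ R)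
      u-suffix = proj₁ (proj₂ halves)
      Consec-prefix : ∀ {u v} → Consec (a ∷ L ∷ʳ x) u v → Consec ((a ∷ L) ++ x ∷ R) u v
      Consec-prefix {u} {v} c = subst (λ K → Consec K u v) (≡-sym assoc) (Consec-++⁺ˡ c)
      lst-suffix : last (x ∷ R) ≡ just b
      lst-suffix = trans (≡-sym (last-++-∷ (a ∷ L) x R)) lst
      length-parts : suc (length L) + length R ≡ ℓ
      length-parts = trans (≡-sym (+-suc (length L) (length R))) (trans (≡-sym (length-++ L)) len)
      inside-prefix : ∀ {v} → v ∈ a ∷ L ∷ʳ x → (S ∩ (_≢ b)) v
      inside-prefix v∈ with ∈-++⁻ (a ∷ L) v∈
      ... | inj₁ v∈L = ss (∈-++⁺ˡ v∈L) , λ { refl → proj₂ (proj₂ halves) (v∈L , last⇒∈ lst-suffix) }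
      ... | inj₂ (here refl) = ss (∈-++⁺ʳ (a ∷ L) (here refl)) , x≢b
      inside-suffix : ∀ {v} → v ∈ x ∷ R → (S ∩ (_≢ a)) v
      inside-suffix v∈ = ss (∈-++⁺ʳ (a ∷ L) v∈) , λ { refl → proj₂ (proj₂ halves) (here refl , v∈) }

  Between : List (Fin n) → ℕ → ℕ → Fin n → Set
  Between K i j w = ∃ λ k → i ≤ k × k ≤ j × At K k w

  Outside : List (Fin n) → ℕ → ℕ → Fin n → Set
  Outside K i j w = ∃ λ k → (k ≤ i ⊎ j ≤ k) × At K k w

  Between⇒∈ : ∀ {K i j v} → Between K i j v → v ∈ K
  Between⇒∈ (_ , _ , _ , at) = At⇒∈ at

  Outside⇒∈ : ∀ {K i j v} → Outside K i j v → v ∈ K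
  Outside⇒∈ (_ , _ , at) = At⇒∈ at

  module Arcs {A B F : List (Fin n)} {u v} (uK : Unique (A ++ u ∷ B ++ v ∷ F))
              (cyc : ∀ {p q} → Consec (close (A ++ u ∷ B ++ v ∷ F)) p q → Edge p q) where

    K : List (Fin n)
    K = A ++ u ∷ B ++ v ∷ F

    private
      inner outer : List (Fin n)
      inner = u ∷ B ∷ʳ v
      outer = v ∷ F ++ A ∷ʳ u

      j : ℕ
      j = length A + suc (length B)

      inner-split : K ≡ A ++ inner ++ F
      inner-split = cong (λ L → A ++ u ∷ L) (≡-sym (++-assoc B [ v ] F))

      rotate : K ≡ (A ∷ʳ u) ++ B ++ v ∷ F
      rotate = ≡-sym (++-assoc A [ u ] (B ++ v ∷ F))

      outer-split : K ++ K ≡ (A ++ u ∷ B) ++ outer ++ B ++ v ∷ F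
      outer-split = begin
        K ++ K                              ≡⟨ ++-assoc A (u ∷ B ++ v ∷ F) K ⟩
        A ++ u ∷ (B ++ v ∷ F) ++ K          ≡⟨ cong (λ L → A ++ u ∷ L) (++-assoc B (v ∷ F) K) ⟩
        A ++ u ∷ B ++ v ∷ F ++ K            ≡⟨ cong (λ L → A ++ u ∷ B ++ v ∷ F ++ L) rotate ⟩
        A ++ u ∷ B ++ v ∷ F ++ (A ∷ʳ u) ++ B ++ v ∷ F
          ≡⟨ cong (λ L → A ++ u ∷ B ++ v ∷ L) (≡-sym (++-assoc F (A ∷ʳ u) (B ++ v ∷ F))) ⟩
        A ++ u ∷ B ++ outer ++ B ++ v ∷ F   ≡⟨ ≡-sym (++-assoc A (u ∷ B) (outer ++ B ++ v ∷ F)) ⟩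
        (A ++ u ∷ B) ++ outer ++ B ++ v ∷ F ∎
        where open ≡-Reasoning

      edges-K : ∀ {p q} → Consec K p q → Edge p q
      edges-K = cyc ∘ Consec-++⁺ˡ

      edges-KK : ∀ {p q} → Consec (K ++ K) p q → Edge p q
      edges-KK c with Consec-++⁻ K c
      ... | inj₁ c′ = edges-K c′
      ... | inj₂ (inj₁ c′) = edges-K c′
      ... | inj₂ (inj₂ (lst , hd)) = cyc (subst (λ L → Consec (K ++ L) _ _) (≡-sym (take-1 K hd)) (Consec-∷ʳ K lst))
        where take-1 : ∀ (L : List (Fin n)) {q} → head L ≡ just q → take 1 L ≡ [ q ]
              take-1 (_ ∷ _) refl = refl

    inner-arc : Path u v (suc (length B)) (Between K (length A) j)
    inner-arc = mkPath (B ∷ʳ v) (length-∷ʳ B v) (Unique-infix A inner F (subst Unique inner-split uK))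
                  (edges-K ∘ subst (λ L → Consec L _ _) (≡-sym inner-split) ∘ Consec-infix A F)
                  (last-∷ʳ (u ∷ B) v) inside
      where
        inside : ∀ {w} → w ∈ inner → Between K (length A) j w
        inside w∈ with k , lo , hi , at ← At-infix A inner F w∈ =
          k , lo , ≤-pred (≤-trans hi (≤-reflexive bound)) ,
          subst (λ L → At L k _) (≡-sym inner-split) at
          where bound : length A + length inner ≡ suc j
                bound = trans (cong (λ k → length A + suc k) (length-∷ʳ B v)) (+-suc (length A) _)

    outer-arc : Path v u (suc (length F + length A)) (Outside K (length A) j)
    outer-arc = mkPath (F ++ A ∷ʳ u) outer-length (proj₁ (proj₂ (Unique-++⁻ B unique-B++outer)))
                  (edges-KK ∘ subst (λ L → Consec L _ _) (≡-sym outer-split) ∘ Consec-infix (A ++ u ∷ B) (B ++ v ∷ F))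
                  (trans (cong last (≡-sym (++-assoc (v ∷ F) A [ u ]))) (last-∷ʳ (v ∷ F ++ A) u)) inside
      where
        unique-B++outer : Unique (B ++ outer)
        unique-B++outer = subst Unique (++-assoc B (v ∷ F) (A ∷ʳ u)) (Unique-swap (A ∷ʳ u) (subst Unique rotate uK))
        outer-length : length (F ++ A ∷ʳ u) ≡ suc (length F + length A)
        outer-length = trans (length-++ F) (trans (cong (length F +_) (length-∷ʳ A u)) (+-suc (length F) (length A)))
        inside : ∀ {w} → w ∈ outer → Outside K (length A) j w
        inside w∈ with ∈-++⁻ (v ∷ F) w∈
        ... | inj₁ w∈F with k , lo , _ , at ← At-infix (A ++ u ∷ B) (v ∷ F) [] w∈F =
          k , inj₂ (≤-trans (≤-reflexive (≡-sym (length-++ A))) lo) ,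
          subst (λ L → At L k _)
            (trans (cong ((A ++ u ∷ B) ++_) (++-identityʳ (v ∷ F))) (++-assoc A (u ∷ B) (v ∷ F))) at
        ... | inj₂ w∈A with k , _ , hi , at ← At-infix [] (A ∷ʳ u) (B ++ v ∷ F) w∈A =
          k , inj₁ (≤-pred (≤-trans hi (≤-reflexive (length-∷ʳ A u)))) , subst (λ L → At L k _) (≡-sym rotate) at

    arc-lengths : suc (length B) + suc (length F + length A) ≡ length K
    arc-lengths = begin
      suc (length B) + suc (length F + length A) ≡⟨ rearrange (length A) (length B) (length F) ⟩
      length A + suc (length B + suc (length F))   ≡⟨ cong (λ k → length A + suc k) (length-++ B) ⟨
      length A + length (u ∷ B ++ v ∷ F)          ≡⟨ length-++ A ⟨
      length K                                     ∎
      where open ≡-Reasoning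
            rearrange : ∀ a b f → suc b + suc (f + a) ≡ a + suc (b + suc f)
            rearrange = solve-∀

  arcs : ∀ {K u v i j} → Unique K → (∀ {p q} → Consec (close K) p q → Edge p q) →
         At K i u → At K j v → i < j →
         ∃₂ λ d d′ → i + d ≡ j × d + d′ ≡ length K × Path u v d (Between K i j) × Path v u d′ (Outside K i j)
  arcs uK cyc (A , _ , refl , refl) (X′ , F , eq , refl) i<j with B , refl , i+d≡j ← ++-∷-split A X′ eq i<j =
    _ , _ , i+d≡j , arc-lengths ,
    subst (λ j → Path _ _ _ (Between _ _ j)) i+d≡j inner-arc ,
    subst (λ j → Path _ _ _ (Outside _ _ j)) i+d≡j outer-arc
    where open Arcs {A} {B} {F} uK cyc

  arcs-between : ∀ {K u v i j} → Unique K → (∀ {p q} → Consec (close K) p q → Edge p q) →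
                 At K i u → At K j v → i ≢ j →
                 ∃₂ λ d d′ → (i + d ≡ j ⊎ j + d ≡ i) × d + d′ ≡ length K × Path u v d (_∈ K) × Path u v d′ (_∈ K)
  arcs-between {i = i} {j} uK cyc at-u at-v i≢j with <-cmp i j
  ... | tri< i<j _ _ with d , d′ , i+d≡j , d+d′≡∣K∣ , inner , outer ← arcs uK cyc at-u at-v i<j =
    d , d′ , inj₁ i+d≡j , d+d′≡∣K∣ , mono Between⇒∈ inner , reversePath (mono Outside⇒∈ outer)
  ... | tri> _ _ j<i with d , d′ , j+d≡i , d+d′≡∣K∣ , inner , outer ← arcs uK cyc at-v at-u j<i =
    d , d′ , inj₂ j+d≡i , d+d′≡∣K∣ , reversePath (mono Between⇒∈ inner) , mono Outside⇒∈ outer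
  ... | tri≈ _ i≡j _ = ⊥-elim (i≢j i≡j)

  two-arcs : ∀ {K u v} → Unique K → (∀ {p q} → Consec (close K) p q → Edge p q) → u ∈ K → v ∈ K → u ≢ v →
             ∃₂ λ d d′ → d + d′ ≡ length K × Path u v d (_∈ K) × Path u v d′ (_∈ K)
  two-arcs uK cyc u∈K v∈K u≢v with i , at-u ← ∈⇒At u∈K | j , at-v ← ∈⇒At v∈K
    with d , d′ , _ , d+d′≡∣K∣ , arc , arc′ ← arcs-between uK cyc at-u at-v
                                               (λ { refl → u≢v (At-functional at-u at-v) }) =
    d , d′ , d+d′≡∣K∣ , arc , arc′

  fromIsPath : ∀ {a b} (L : List (Fin n)) → IsPath G L a b → (∀ {u v} → Consec L u v → E u v) →
               Σ (Path a b (length L ∸ 1) (_∈ L)) λ p → a ∷ Path.tail p ≡ L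
  fromIsPath (_ ∷ L) (u , linked , refl , lst) es =
    mkPath L refl u (λ c → Linked⇒Consec linked c , es c) lst (λ v∈ → v∈) , refl

-- The configuration of the lemma

module Configuration {n : ℕ} (G : Graph n) (C P₁ P₂ D Q₁ Q₂ : List (Fin n)) (a₁ b₁ a₂ b₂ x y : Fin n)
  (C-cycle : IsCycle G C) (bridge₁ : Bridge G C P₁ a₁ b₁) (bridge₂ : Bridge G C P₂ a₂ b₂)
  (P₁∩P₂≡∅ : ∀ v → v ∈ P₁ → v ∉ P₂) (R-adjustable : IsAdjustable G D Q₁ Q₂ x y)
  (x∈P₁ : x ∈ P₁) (x∉C : x ∉ C) (y∈P₂ : y ∈ P₂) (y∉C : y ∉ C)
  (R∩P : ∀ v → RVert D Q₁ Q₂ v → v ∈ P₁ ⊎ v ∈ P₂ → v ≡ x ⊎ v ≡ y)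
  (R∩C : ∀ v → RVert D Q₁ Q₂ v → v ∉ C) where

  E : Fin n → Fin n → Set
  E u v = CEdge C u v ⊎ PEdge P₁ u v ⊎ PEdge P₂ u v ⊎ REdge D Q₁ Q₂ u v

  E-sym : ∀ {u v} → E u v → E v u
  E-sym = ⊎-map swap (⊎-map swap (⊎-map swap (⊎-map swap (⊎-map swap swap))))

  open Paths G E E-sym public

  DivisibleCycle : Set
  DivisibleCycle = ∃ λ Z → IsCycle G Z × (∀ u v → CEdge Z u v → E u v) × 4 ∣ length Z

  divisible : ∀ {k} → Cycle k → 4 ∣ k → DivisibleCycle
  divisible (Z , Z-cycle , Z-edges , refl) 4∣k = Z , Z-cycle , Z-edges , 4∣k

  divisible-of-two : ∀ {a b} → Cycle a → Cycle b → Even a → 4 ∣ (a + b) + 2 → DivisibleCycle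
  divisible-of-two {a} {b} Za Zb even-a 4∣sum with even∧4∣m+n+2⇒4∣m⊎4∣n {a} {b} even-a 4∣sum
  ... | inj₁ 4∣a = divisible Za 4∣a
  ... | inj₂ 4∣b = divisible Zb 4∣b

  M : ℕ
  M = length C

  C-unique : Unique C
  C-unique = proj₁ (proj₂ C-cycle)

  C-edges : ∀ {p q} → Consec (close C) p q → Edge p q
  C-edges c = Linked⇒Consec (proj₂ (proj₂ C-cycle)) c , inj₁ (inj₁ c)

  arc-up : ∀ {u v i j} → At C i u → At C j v → i < j → ∃ λ d → i + d ≡ j × Path u v d (_∈ C)
  arc-up at-u at-v i<j with d , _ , i+d≡j , _ , inner , _ ← arcs C-unique C-edges at-u at-v i<j =
    d , i+d≡j , mono Between⇒∈ inner

  arc-down : ∀ {u v i j} → At C i u → At C j v → j < i → ∃ λ d → j + d ≡ i × Path u v d (_∈ C)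
  arc-down at-u at-v j<i with d , i+d≡j , p ← arc-up at-v at-u j<i = d , i+d≡j , reversePath p

  record SplitBridge (e f w : Fin n) (P : List (Fin n)) : Set where
    field
      α β     : ℕ
      to-e    : Path w e α (λ v → v ∈ P × v ≢ f)
      to-f    : Path w f β (λ v → v ∈ P × v ≢ e)
      whole   : Path e f (α + β) (_∈ P)
      meets-C : ∀ {v} → v ∈ P → v ∈ C → v ≡ e ⊎ v ≡ f
      e∈C     : e ∈ C
      f∈C     : f ∈ C
      w∉C     : w ∉ C

    e∈P : e ∈ P
    e∈P = Path.inside whole (here refl)

    f∈P : f ∈ P
    f∈P = Path.inside whole (last⇒∈ (Path.last≡ whole))

    1≤α : 1 ≤ α
    1≤α = 1≤length (∉⇒≢ w∉C e∈C) to-e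

    1≤β : 1 ≤ β
    1≤β = 1≤length (∉⇒≢ w∉C f∈C) to-f

    ℓ : ℕ
    ℓ = α + β

    2≤ℓ : 2 ≤ ℓ
    2≤ℓ = +-mono-≤ 1≤α 1≤β

    to-e∩C : ∀ {v} → v ∈ P × v ≢ f → v ∈ C → v ≡ e
    to-e∩C (v∈P , v≢f) v∈C with meets-C v∈P v∈C
    ... | inj₁ v≡e = v≡e
    ... | inj₂ v≡f = ⊥-elim (v≢f v≡f)

    e≢f : e ≢ f
    e≢f refl with () ← subst (1 ≤_) (loop-length≡0 whole) (≤-trans 1≤α (m≤m+n α β))

  split-bridge : ∀ {e f w P} → Bridge G C P e f → (∀ {u v} → Consec P u v → E u v) → w ∈ P → w ∉ C →
                 SplitBridge e f w P
  split-bridge {e} {f} {w} {P} (is-path , _ , _ , e∈C , f∈C , meets) es w∈P w∉C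
    with whole , vertices≡P ← fromIsPath P is-path es
    with α , β , α+β , to-e , to-f ← split whole (subst (w ∈_) (≡-sym vertices≡P) w∈P)
                                            (∉⇒≢ w∉C e∈C) (∉⇒≢ w∉C f∈C) = record
      { α = α ; β = β ; to-e = to-e ; to-f = to-f
      ; whole = subst (λ ℓ → Path e f ℓ (_∈ P)) (≡-sym α+β) whole
      ; meets-C = λ {v} → meets v ; e∈C = e∈C ; f∈C = f∈C ; w∉C = w∉C }

  flip : ∀ {e f w P} → SplitBridge e f w P → SplitBridge f e w P
  flip {e} {f} {P = P} B = record
    { α = β ; β = α ; to-e = to-f ; to-f = to-e
    ; whole = subst (λ ℓ → Path f e ℓ (_∈ P)) (+-comm α β) (reversePath whole)
    ; meets-C = λ v∈P v∈C → swap (meets-C v∈P v∈C) ; e∈C = f∈C ; f∈C = e∈C ; w∉C = w∉C }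
    where open SplitBridge B

  record OrientedBridge (w : Fin n) (P : List (Fin n)) : Set where
    field
      lo hi    : Fin n
      l h gap  : ℕ
      at-lo    : At C l lo
      at-hi    : At C h hi
      l<h      : l < h
      l+gap≡h  : l + gap ≡ h
      even-gap : Even gap
      bridge   : SplitBridge lo hi w P

    parity-hi : parity h ≡ parity l
    parity-hi = trans (cong parity (≡-sym l+gap≡h)) (trans (parity-+ l gap refl even-gap) (ℙ+-identityʳ (parity l)))

  orient : ∀ {e f w P} → Even M → EvenSpan C e f → SplitBridge e f w P → OrientedBridge w P
  orient even-M (s , (i , j , refl , refl , s≡span) , 2∣s) B with <-cmp (toℕ i) (toℕ j)
  ... | tri< i<j _ _ = record
    { at-lo = lookup⇒At C i ; at-hi = lookup⇒At C j ; l<h = i<j ; l+gap≡h = m+[n∸m]≡n (<⇒≤ i<j)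
    ; even-gap = even-span⇒even-gap (<⇒≤ i<j) (<⇒≤ (toℕ<n j)) even-M (subst Even s≡span (2∣⇒even 2∣s))
    ; bridge = B }
  ... | tri> _ _ j<i = record
    { at-lo = lookup⇒At C j ; at-hi = lookup⇒At C i ; l<h = j<i ; l+gap≡h = m+[n∸m]≡n (<⇒≤ j<i)
    ; even-gap = even-span⇒even-gap (<⇒≤ j<i) (<⇒≤ (toℕ<n i)) even-M
                   (subst Even (trans s≡span (cong (λ d → d ⊓ (M ∸ d)) (∣-∣-comm (toℕ i) (toℕ j)))) (2∣⇒even 2∣s))
    ; bridge = flip B }
  ... | tri≈ _ i≡j _ = ⊥-elim (SplitBridge.e≢f B (cong (lookup C) (toℕ-injective i≡j)))

  RVertex : Fin n → Set
  RVertex = RVert D Q₁ Q₂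

  adjustable⇒paths : IsAdjustable G D Q₁ Q₂ x y →
                     ∃₂ λ r r′ → Path x y r RVertex × Path x y r′ RVertex × Odd (r + r′)
  adjustable⇒paths ((_ , D-unique , D-linked) , D-odd , (d₁ , Q₁-path , d₁∈D , Q₁∩D) ,
                    (d₂ , Q₂-path , d₂∈D , Q₂∩D) , Q₁∩Q₂≡∅)
    = around (two-arcs D-unique D-edges d₁∈D d₂∈D d₁≢d₂)
    where
      D-edges : ∀ {p q} → Consec (close D) p q → Edge p q
      D-edges c = Linked⇒Consec D-linked c , inj₂ (inj₂ (inj₂ (inj₁ (inj₁ c))))
      d₁≢d₂ : d₁ ≢ d₂
      d₁≢d₂ refl = Q₁∩Q₂≡∅ d₁ (last⇒∈ (proj₂ (proj₂ (proj₂ Q₁-path)))) (head⇒∈ (proj₁ (proj₂ (proj₂ Q₂-path))))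
      q₁ q₂ : ℕ
      q₁ = length Q₁ ∸ 1
      q₂ = length Q₂ ∸ 1
      Q₁-walk : Path x d₁ q₁ (_∈ Q₁)
      Q₁-walk = proj₁ (fromIsPath Q₁ Q₁-path (λ c → inj₂ (inj₂ (inj₂ (inj₂ (inj₁ (inj₁ c)))))))
      Q₂-walk : Path d₂ y q₂ (_∈ Q₂)
      Q₂-walk = proj₁ (fromIsPath Q₂ Q₂-path (λ c → inj₂ (inj₂ (inj₂ (inj₂ (inj₂ (inj₁ c)))))))
      through : ∀ {k} → Path d₁ d₂ k (_∈ D) → Path x y ((q₁ + k) + q₂) RVertex
      through arc = mono into-R (concat (concat Q₁-walk arc (λ (v∈Q₁ , v∈D) → Q₁∩D _ v∈Q₁ v∈D)) Q₂-walk meet)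
        where
          meet : ∀ {v} → (v ∈ Q₁ ⊎ v ∈ D) × v ∈ Q₂ → v ≡ d₂
          meet (inj₁ v∈Q₁ , v∈Q₂) = ⊥-elim (Q₁∩Q₂≡∅ _ v∈Q₁ v∈Q₂)
          meet (inj₂ v∈D  , v∈Q₂) = Q₂∩D _ v∈Q₂ v∈D
          into-R : ∀ {v} → (v ∈ Q₁ ⊎ v ∈ D) ⊎ v ∈ Q₂ → RVertex v
          into-R (inj₁ (inj₁ v∈Q₁)) = inj₂ (inj₁ v∈Q₁)
          into-R (inj₁ (inj₂ v∈D))  = inj₁ v∈D
          into-R (inj₂ v∈Q₂)        = inj₂ (inj₂ v∈Q₂)
      around : (∃₂ λ k k′ → k + k′ ≡ length D × Path d₁ d₂ k (_∈ D) × Path d₁ d₂ k′ (_∈ D)) →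
               ∃₂ λ r r′ → Path x y r RVertex × Path x y r′ RVertex × Odd (r + r′)
      around (k , k′ , k+k′≡∣D∣ , arc , arc′) =
        _ , _ , through arc , through arc′ ,
        subst Odd (rearrange q₁ q₂ k k′)
          (parity-+ ((q₁ + q₂) + (q₁ + q₂)) (k + k′) (even-n+n (q₁ + q₂)) (subst Odd (≡-sym k+k′≡∣D∣) (2∤⇒odd D-odd)))
        where rearrange : ∀ a b c d → ((a + b) + (a + b)) + (c + d) ≡ ((a + c) + b) + ((a + d) + b)
              rearrange = solve-∀

  R-path-of-parity : ∀ π → ∃ λ ρ → Path x y ρ RVertex × parity ρ ≡ π
  R-path-of-parity π with adjustable⇒paths R-adjustable
  ... | r , r′ , R , R′ , odd with parity r in er | parity r′ in er′ | π
  ...   | 0ℙ | 1ℙ | 0ℙ = r  , R  , er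
  ...   | 0ℙ | 1ℙ | 1ℙ = r′ , R′ , er′
  ...   | 1ℙ | 0ℙ | 0ℙ = r′ , R′ , er′
  ...   | 1ℙ | 0ℙ | 1ℙ = r  , R  , er
  ...   | 0ℙ | 0ℙ | _ with () ← trans (≡-sym (parity-+ r r′ er er′)) odd
  ...   | 1ℙ | 1ℙ | _ with () ← trans (≡-sym (parity-+ r r′ er er′)) odd

  bridge-cycle : ∀ {e f w P d} (B : SplitBridge e f w P) → Path f e d (_∈ C) → Cycle (SplitBridge.ℓ B + d)
  bridge-cycle B arc = close-cycle whole arc (λ (v∈P , v∈C) → meets-C v∈P v∈C)
                         (+-mono-≤ 2≤ℓ (1≤length (e≢f ∘ ≡-sym) arc))
    where open SplitBridge B

  R-cycle : ∀ {e₁ f₁ e₂ f₂ d ρ} (B₁ : SplitBridge e₁ f₁ x P₁) (B₂ : SplitBridge e₂ f₂ y P₂) →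
            Path e₁ e₂ d (_∈ C) → Path x y ρ RVertex →
            Cycle (((SplitBridge.α B₁ + d) + SplitBridge.α B₂) + ρ)
  R-cycle {f₁ = f₁} {e₂} {f₂} {ρ = ρ} B₁ B₂ arc R =
    close-cycle (concat (concat (to-e B₁) arc (λ (v∈P₁ , v∈C) → to-e∩C B₁ v∈P₁ v∈C)) (reversePath (to-e B₂)) meet)
      (reversePath R) meet-R
      (≤-trans (+-mono-≤ (+-mono-≤ (1≤α B₁) (1≤length e₁≢e₂ arc)) (1≤α B₂)) (m≤m+n _ ρ))
    where
      open SplitBridge
      e₁≢e₂ : _ ≢ e₂
      e₁≢e₂ refl = P₁∩P₂≡∅ _ (e∈P B₁) (e∈P B₂)
      meet : ∀ {v} → ((v ∈ P₁ × v ≢ f₁) ⊎ v ∈ C) × (v ∈ P₂ × v ≢ f₂) → v ≡ e₂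
      meet (inj₁ (v∈P₁ , _) , (v∈P₂ , _)) = ⊥-elim (P₁∩P₂≡∅ _ v∈P₁ v∈P₂)
      meet (inj₂ v∈C , v∈P₂∖f₂)          = to-e∩C B₂ v∈P₂∖f₂ v∈C
      meet-R : ∀ {v} → (((v ∈ P₁ × v ≢ f₁) ⊎ v ∈ C) ⊎ (v ∈ P₂ × v ≢ f₂)) × RVertex v → v ≡ x ⊎ v ≡ y
      meet-R (inj₁ (inj₁ (v∈P₁ , _)) , v∈R) = R∩P _ v∈R (inj₁ v∈P₁)
      meet-R (inj₁ (inj₂ v∈C) , v∈R)        = ⊥-elim (R∩C _ v∈R v∈C)
      meet-R (inj₂ (v∈P₂ , _) , v∈R)        = R∩P _ v∈R (inj₂ v∈P₂)

  module _ {e f w P qe qf} (B : SplitBridge e f w P) (at-e : At C qe e) (at-f : At C qf f) where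

    off-e⇒f : ∀ {v q} → v ∈ P → At C q v → q ≢ qe → v ≡ f
    off-e⇒f v∈P at-v q≢qe with SplitBridge.meets-C B v∈P (At⇒∈ at-v)
    ... | inj₁ refl = ⊥-elim (q≢qe (At-injective C-unique at-v at-e))
    ... | inj₂ v≡f  = v≡f

    off-f⇒e : ∀ {v q} → v ∈ P → At C q v → q ≢ qf → v ≡ e
    off-f⇒e v∈P at-v q≢qf with SplitBridge.meets-C B v∈P (At⇒∈ at-v)
    ... | inj₁ v≡e  = v≡e
    ... | inj₂ refl = ⊥-elim (q≢qf (At-injective C-unique at-v at-f))

  module Crossing {k₁ k₂ k₃ k₄ w₁ w₂ U W q₁ q₂ q₃ q₄}
    (B : SplitBridge k₁ k₃ w₁ U) (B′ : SplitBridge k₂ k₄ w₂ W) (U∩W≡∅ : ∀ v → v ∈ U → v ∉ W)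
    (at₁ : At C q₁ k₁) (at₂ : At C q₂ k₂) (at₃ : At C q₃ k₃) (at₄ : At C q₄ k₄)
    (q₁<q₂ : q₁ < q₂) (q₂<q₃ : q₂ < q₃) (q₃<q₄ : q₃ < q₄) where

    private
      open SplitBridge
      3≤ : ∀ g g′ → 3 ≤ ((ℓ B + g) + ℓ B′) + g′
      3≤ g g′ = ≤-trans (+-mono-≤ (≤-trans (2≤ℓ B) (m≤m+n _ g)) (≤-trans (s≤s z≤n) (2≤ℓ B′))) (m≤m+n _ g′)
      U-meets : ∀ {v q} → v ∈ U → At C q v → q ≢ q₁ → v ≡ k₃
      U-meets = off-e⇒f B at₁ at₃
      U-meets′ : ∀ {v q} → v ∈ U → At C q v → q ≢ q₃ → v ≡ k₁
      U-meets′ = off-f⇒e B at₁ at₃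
      W-meets : ∀ {v q} → v ∈ W → At C q v → q ≢ q₂ → v ≡ k₄
      W-meets = off-e⇒f B′ at₂ at₄
      W-meets′ : ∀ {v q} → v ∈ W → At C q v → q ≢ q₄ → v ≡ k₂
      W-meets′ = off-f⇒e B′ at₂ at₄

    inner-cycle : ∀ {g₁₂ g₃₄} → Path k₁ k₂ g₁₂ (Between C q₁ q₂) → Path k₃ k₄ g₃₄ (Between C q₃ q₄) →
                  Cycle (((ℓ B + g₃₄) + ℓ B′) + g₁₂)
    inner-cycle {g₁₂} {g₃₄} arc₁₂ arc₃₄ =
      close-cycle (concat (concat (whole B) arc₃₄ meet₁) (reversePath (whole B′)) meet₂) (reversePath arc₁₂) meet₃
        (3≤ g₃₄ g₁₂)
      where
        meet₁ : ∀ {v} → v ∈ U × Between C q₃ q₄ v → v ≡ k₃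
        meet₁ (v∈U , _ , q₃≤k , _ , at) = U-meets v∈U at (<∧≤⇒≢ (<-trans q₁<q₂ q₂<q₃) q₃≤k)
        meet₂ : ∀ {v} → (v ∈ U ⊎ Between C q₃ q₄ v) × v ∈ W → v ≡ k₄
        meet₂ (inj₁ v∈U , v∈W)                 = ⊥-elim (U∩W≡∅ _ v∈U v∈W)
        meet₂ (inj₂ (_ , q₃≤k , _ , at) , v∈W) = W-meets v∈W at (<∧≤⇒≢ q₂<q₃ q₃≤k)
        meet₃ : ∀ {v} → ((v ∈ U ⊎ Between C q₃ q₄ v) ⊎ v ∈ W) × Between C q₁ q₂ v → v ≡ k₁ ⊎ v ≡ k₂
        meet₃ (inj₁ (inj₁ v∈U) , _ , _ , k≤q₂ , at) = inj₁ (U-meets′ v∈U at (≤∧<⇒≢ k≤q₂ q₂<q₃))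
        meet₃ (inj₁ (inj₂ (_ , q₃≤k , _ , at)) , _ , _ , k′≤q₂ , at′)
          with refl ← At-injective C-unique at at′ = ⊥-elim (<⇒≱ q₂<q₃ (≤-trans q₃≤k k′≤q₂))
        meet₃ (inj₂ v∈W , _ , _ , k≤q₂ , at) = inj₂ (W-meets′ v∈W at (≤∧<⇒≢ k≤q₂ (<-trans q₂<q₃ q₃<q₄)))

    outer-cycle : ∀ {g₂₃ g₄₁} → Path k₂ k₃ g₂₃ (Between C q₂ q₃) → Path k₄ k₁ g₄₁ (Outside C q₁ q₄) →
                  Cycle (((ℓ B + g₂₃) + ℓ B′) + g₄₁)
    outer-cycle {g₂₃} {g₄₁} arc₂₃ arc₄₁ =
      close-cycle (concat (concat (whole B) (reversePath arc₂₃) meet₁) (whole B′) meet₂) arc₄₁ meet₃ (3≤ g₂₃ g₄₁)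
      where
        meet₁ : ∀ {v} → v ∈ U × Between C q₂ q₃ v → v ≡ k₃
        meet₁ (v∈U , _ , q₂≤k , _ , at) = U-meets v∈U at (<∧≤⇒≢ q₁<q₂ q₂≤k)
        meet₂ : ∀ {v} → (v ∈ U ⊎ Between C q₂ q₃ v) × v ∈ W → v ≡ k₂
        meet₂ (inj₁ v∈U , v∈W)                 = ⊥-elim (U∩W≡∅ _ v∈U v∈W)
        meet₂ (inj₂ (_ , _ , k≤q₃ , at) , v∈W) = W-meets′ v∈W at (≤∧<⇒≢ k≤q₃ q₃<q₄)
        meet₃ : ∀ {v} → ((v ∈ U ⊎ Between C q₂ q₃ v) ⊎ v ∈ W) × Outside C q₁ q₄ v → v ≡ k₁ ⊎ v ≡ k₄
        meet₃ (inj₁ (inj₁ v∈U) , _ , inj₁ k≤q₁ , at) = inj₁ (U-meets′ v∈U at (≤∧<⇒≢ k≤q₁ (<-trans q₁<q₂ q₂<q₃)))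
        meet₃ (inj₁ (inj₁ v∈U) , _ , inj₂ q₄≤k , at) = inj₁ (U-meets′ v∈U at (<∧≤⇒≢ q₃<q₄ q₄≤k))
        meet₃ (inj₁ (inj₂ (_ , q₂≤k , k≤q₃ , at)) , _ , out , at′) with refl ← At-injective C-unique at at′ | out
        ... | inj₁ k≤q₁ = ⊥-elim (<⇒≱ q₁<q₂ (≤-trans q₂≤k k≤q₁))
        ... | inj₂ q₄≤k = ⊥-elim (<⇒≱ q₃<q₄ (≤-trans q₄≤k k≤q₃))
        meet₃ (inj₂ v∈W , _ , inj₁ k≤q₁ , at) = inj₂ (W-meets v∈W at (≤∧<⇒≢ k≤q₁ q₁<q₂))
        meet₃ (inj₂ v∈W , _ , inj₂ q₄≤k , at) = inj₂ (W-meets v∈W at (<∧≤⇒≢ (<-trans q₂<q₃ q₃<q₄) q₄≤k))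

    crossing-case : Odd (ℓ B) → Odd (ℓ B′) →
                    parity q₁ ℙ.+ parity q₂ ≡ 1ℙ → parity q₃ ≡ parity q₁ → parity q₄ ≡ parity q₂ →
                    4 ∣ M + 2 → DivisibleCycle
    crossing-case odd-ℓ odd-ℓ′ cross par₃ par₄ 4∣M+2
      with g₁₂ , _ , q₁+g₁₂≡q₂ , _ , arc₁₂ , _ ← arcs C-unique C-edges at₁ at₂ q₁<q₂
      with g₂₃ , _ , q₂+g₂₃≡q₃ , _ , arc₂₃ , _ ← arcs C-unique C-edges at₂ at₃ q₂<q₃
      with g₃₄ , _ , q₃+g₃₄≡q₄ , _ , arc₃₄ , _ ← arcs C-unique C-edges at₃ at₄ q₃<q₄
      with d₁₄ , g₄₁ , q₁+d₁₄≡q₄ , d₁₄+g₄₁≡M , _ , arc₄₁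
             ← arcs C-unique C-edges at₁ at₄ (<-trans q₁<q₂ (<-trans q₂<q₃ q₃<q₄)) =
      divisible-of-two (inner-cycle arc₁₂ arc₃₄) (outer-cycle arc₂₃ arc₄₁) even-inner
        (subst (4 ∣_) (rearrange (ℓ B) (ℓ B′) g₁₂ g₂₃ g₃₄ g₄₁)
          (∣m∣n⇒∣m+n (even⇒4∣n+n {ℓ B + ℓ B′} even-ℓℓ′) (subst (λ m → 4 ∣ m + 2) (≡-sym gaps≡M) 4∣M+2)))
      where
        even-ℓℓ′ : Even (ℓ B + ℓ B′)
        even-ℓℓ′ = parity-+ (ℓ B) (ℓ B′) odd-ℓ odd-ℓ′
        odd₁₂ : Odd g₁₂
        odd₁₂ = trans (gap-parity {q₁} {g₁₂} q₁+g₁₂≡q₂) cross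
        odd₃₄ : Odd g₃₄
        odd₃₄ = trans (gap-parity {q₃} {g₃₄} q₃+g₃₄≡q₄) (trans (cong₂ ℙ._+_ par₃ par₄) cross)
        even-inner : Even (((ℓ B + g₃₄) + ℓ B′) + g₁₂)
        even-inner = subst Even (regroup (ℓ B) (ℓ B′) g₁₂ g₃₄)
                       (parity-+ (ℓ B + ℓ B′) (g₃₄ + g₁₂) even-ℓℓ′ (parity-+ g₃₄ g₁₂ odd₃₄ odd₁₂))
          where regroup : ∀ p p′ g g′ → (p + p′) + (g′ + g) ≡ ((p + g′) + p′) + g
                regroup = solve-∀
        gaps≡M : ((g₁₂ + g₂₃) + g₃₄) + g₄₁ ≡ M
        gaps≡M = trans (cong (_+ g₄₁) (consecutive-gaps q₁ g₁₂ g₂₃ g₃₄ d₁₄ q₁+g₁₂≡q₂ q₂+g₂₃≡q₃ q₃+g₃₄≡q₄ q₁+d₁₄≡q₄))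
                       d₁₄+g₄₁≡M
        rearrange : ∀ p p′ g₁₂ g₂₃ g₃₄ g₄₁ → ((p + p′) + (p + p′)) + ((((g₁₂ + g₂₃) + g₃₄) + g₄₁) + 2) ≡
                    ((((p + g₃₄) + p′) + g₁₂) + (((p + g₂₃) + p′) + g₄₁)) + 2
        rearrange = solve-∀

  R-path-completing : ∀ {t} → Even t → ∃ λ ρ → Path x y ρ RVertex × 4 ∣ (t + (ρ + ρ)) + 2
  R-path-completing {t} even-t with even⇒4∣n⊎4∣n+2 {t} even-t
  ... | inj₁ 4∣t with ρ , R , odd-ρ ← R-path-of-parity 1ℙ =
    ρ , R , subst (4 ∣_) (≡-sym (+-assoc t (ρ + ρ) 2)) (∣m∣n⇒∣m+n 4∣t (odd⇒4∣n+n+2 {ρ} odd-ρ))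
  ... | inj₂ 4∣t+2 with ρ , R , even-ρ ← R-path-of-parity 0ℙ =
    ρ , R , subst (4 ∣_) (rearrange t ρ) (∣m∣n⇒∣m+n 4∣t+2 (even⇒4∣n+n {ρ} even-ρ))
    where rearrange : ∀ t ρ → (t + 2) + (ρ + ρ) ≡ (t + (ρ + ρ)) + 2
          rearrange = solve-∀

  -- Pick ρ with (u + ρ) + (v + ρ) ≡ 2 (mod 4); since u + w is odd, u + ρ or w + ρ is even.
  four-R-cycles : ∀ {u v w z c} →
                  (∀ {ρ} → Path x y ρ RVertex → Cycle (u + ρ) × Cycle (v + ρ) × Cycle (w + ρ) × Cycle (z + ρ)) →
                  Odd (u + w) → Even (u + v) → w + z ≡ (u + v) + (c + c) → Even c → DivisibleCycle
  four-R-cycles {u} {v} {w} {z} {c} cycles odd-uw even-uv w+z≡u+v+2c even-c =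
    with-R-path (R-path-completing {u + v} even-uv)
    where
      rearrange : ∀ a b ρ → (a + b) + (ρ + ρ) ≡ (a + ρ) + (b + ρ)
      rearrange = solve-∀
      with-R-path : (∃ λ ρ → Path x y ρ RVertex × 4 ∣ ((u + v) + (ρ + ρ)) + 2) → DivisibleCycle
      with-R-path (ρ , R , 4∣uvρ) with Zu , Zv , Zw , Zz ← cycles R
        with odd-sum⇒even-summand {u + ρ} {w + ρ}
               (subst Odd (rearrange u w ρ) (parity-+ (u + w) (ρ + ρ) odd-uw (even-n+n ρ)))
      ... | inj₁ even-uρ = divisible-of-two Zu Zv even-uρ (subst (λ k → 4 ∣ k + 2) (rearrange u v ρ) 4∣uvρ)
      ... | inj₂ even-wρ =
        divisible-of-two Zw Zz even-wρ (subst (4 ∣_) wz-sum (∣m∣n⇒∣m+n 4∣uvρ (even⇒4∣n+n {c} even-c)))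
        where
          wz-sum : (((u + v) + (ρ + ρ)) + 2) + (c + c) ≡ ((w + ρ) + (z + ρ)) + 2
          wz-sum = begin
            (((u + v) + (ρ + ρ)) + 2) + (c + c)  ≡⟨ shuffle (u + v) (c + c) (ρ + ρ) ⟩
            (((u + v) + (c + c)) + (ρ + ρ)) + 2  ≡⟨ cong (λ k → (k + (ρ + ρ)) + 2) w+z≡u+v+2c ⟨
            ((w + z) + (ρ + ρ)) + 2              ≡⟨ cong (_+ 2) (rearrange w z ρ) ⟩
            ((w + ρ) + (z + ρ)) + 2              ∎
            where open ≡-Reasoning
                  shuffle : ∀ a b c → ((a + c) + 2) + b ≡ ((a + b) + c) + 2
                  shuffle = solve-∀

  positions-differ : ∀ {u v i j} → u ∈ P₁ → v ∈ P₂ → At C i u → At C j v → i ≢ j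
  positions-differ u∈P₁ v∈P₂ at-u at-v refl with refl ← At-functional at-u at-v = P₁∩P₂≡∅ _ u∈P₁ v∈P₂

  module _ {w P} (o : OrientedBridge w P) where
    open OrientedBridge o
    open SplitBridge bridge

    even-bridge-case : Even ℓ → 4 ∣ M + 2 → DivisibleCycle
    even-bridge-case even-ℓ 4∣M+2
      with d , d′ , direction , d+d′≡M , arc , arc′ ← arcs-between C-unique C-edges at-lo at-hi (<⇒≢ l<h) =
      divisible-of-two (bridge-cycle bridge (reversePath arc)) (bridge-cycle bridge (reversePath arc′))
        (parity-+ ℓ d even-ℓ even-d)
        (subst (4 ∣_) (trans (cong (λ m → (ℓ + ℓ) + (m + 2)) (≡-sym d+d′≡M)) (rearrange ℓ d d′))
          (∣m∣n⇒∣m+n (even⇒4∣n+n {ℓ} even-ℓ) 4∣M+2))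
      where
        even-d : Even d
        even-d = trans (gap-parity-either {l} {d} direction)
                       (trans (cong (parity l ℙ.+_) parity-hi) (p+p≡0ℙ (parity l)))
        rearrange : ∀ p d d′ → (p + p) + ((d + d′) + 2) ≡ ((p + d) + (p + d′)) + 2
        rearrange = solve-∀

  module TwoBridges (o₁ : OrientedBridge x P₁) (o₂ : OrientedBridge y P₂) where
    open OrientedBridge o₁ public using () renaming
      (lo to lo₁; hi to hi₁; l to l₁; h to h₁; gap to gap₁; at-lo to at-lo₁; at-hi to at-hi₁; l<h to l₁<h₁;
       l+gap≡h to l₁+gap₁≡h₁; even-gap to even-gap₁; bridge to B₁; parity-hi to parity-h₁)
    open OrientedBridge o₂ public using () renaming
      (lo to lo₂; hi to hi₂; l to l₂; h to h₂; gap to gap₂; at-lo to at-lo₂; at-hi to at-hi₂; l<h to l₂<h₂;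
       l+gap≡h to l₂+gap₂≡h₂; even-gap to even-gap₂; bridge to B₂; parity-hi to parity-h₂)
    open SplitBridge B₁ public using () renaming (α to α₁; β to β₁; ℓ to ℓ₁; e∈P to lo₁∈P₁; f∈P to hi₁∈P₁)
    open SplitBridge B₂ public using () renaming (α to α₂; β to β₂; ℓ to ℓ₂; e∈P to lo₂∈P₂; f∈P to hi₂∈P₂)

    even-cross-case : parity l₁ ℙ.+ parity l₂ ≡ 0ℙ → 4 ∣ M + 2 → DivisibleCycle
    even-cross-case even-cross 4∣M+2
      with d , d′ , direction , d+d′≡M , arc , arc′ ← arcs-between C-unique C-edges at-lo₁ at-lo₂
                                                         (positions-differ lo₁∈P₁ lo₂∈P₂ at-lo₁ at-lo₂)
      with ρ , R , parity-ρ ← R-path-of-parity (parity (α₁ + α₂)) =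
      divisible-of-two (R-cycle B₁ B₂ arc R) (R-cycle B₁ B₂ arc′ R)
        (subst Even (regroup α₁ α₂ ρ d)
          (parity-+ t d even-t (trans (gap-parity-either {l₁} {d} direction) even-cross)))
        (subst (4 ∣_) (trans (cong (λ m → (t + t) + (m + 2)) (≡-sym d+d′≡M)) (rearrange α₁ α₂ ρ d d′))
          (∣m∣n⇒∣m+n (even⇒4∣n+n {t} even-t) 4∣M+2))
      where
        t : ℕ
        t = (α₁ + α₂) + ρ
        even-t : Even t
        even-t = trans (parity-+ (α₁ + α₂) ρ refl parity-ρ) (p+p≡0ℙ (parity (α₁ + α₂)))
        regroup : ∀ a a′ ρ d → ((a + a′) + ρ) + d ≡ ((a + d) + a′) + ρ
        regroup = solve-∀
        rearrange : ∀ a a′ ρ d d′ → (((a + a′) + ρ) + ((a + a′) + ρ)) + ((d + d′) + 2) ≡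
                    ((((a + d) + a′) + ρ) + (((a + d′) + a′) + ρ)) + 2
        rearrange = solve-∀

    noncrossing-case : Odd ℓ₁ → Odd ℓ₂ → ∀ {dLL dLH dHL dHH c} →
                       Path lo₁ lo₂ dLL (_∈ C) → Path lo₁ hi₂ dLH (_∈ C) →
                       Path hi₁ lo₂ dHL (_∈ C) → Path hi₁ hi₂ dHH (_∈ C) →
                       Odd dLL → Odd dHL → Odd dHH → dLH + dHL ≡ (dLL + dHH) + (c + c) → Even c → DivisibleCycle
    noncrossing-case odd-ℓ₁ odd-ℓ₂ {dLL} {dLH} {dHL} {dHH} {c} LL LH HL HH odd-LL odd-HL odd-HH gaps even-c =
      four-R-cycles {c = c}
        (λ R → R-cycle B₁ B₂ LL R , R-cycle (flip B₁) (flip B₂) HH R ,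
               R-cycle (flip B₁) B₂ HL R , R-cycle B₁ (flip B₂) LH R)
        (subst Odd (regroup-uw α₁ β₁ α₂ dLL dHL)
          (parity-+ (ℓ₁ + (dLL + dHL)) (α₂ + α₂) (parity-+ ℓ₁ (dLL + dHL) odd-ℓ₁ (parity-+ dLL dHL odd-LL odd-HL))
            (even-n+n α₂)))
        (subst Even (regroup-uv α₁ β₁ α₂ β₂ dLL dHH)
          (parity-+ (ℓ₁ + ℓ₂) (dLL + dHH) (parity-+ ℓ₁ ℓ₂ odd-ℓ₁ odd-ℓ₂) (parity-+ dLL dHH odd-LL odd-HH)))
        (begin
          ((β₁ + dHL) + α₂) + ((α₁ + dLH) + β₂)           ≡⟨ regroup-wz α₁ β₁ α₂ β₂ dLH dHL ⟩
          (ℓ₁ + ℓ₂) + (dLH + dHL)                         ≡⟨ cong ((ℓ₁ + ℓ₂) +_) gaps ⟩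
          (ℓ₁ + ℓ₂) + ((dLL + dHH) + (c + c))             ≡⟨ regroup-uv+2c α₁ β₁ α₂ β₂ dLL dHH (c + c) ⟩
          (((α₁ + dLL) + α₂) + ((β₁ + dHH) + β₂)) + (c + c) ∎)
        even-c
      where
        open ≡-Reasoning
        regroup-uw : ∀ a b a′ d e → ((a + b) + (d + e)) + (a′ + a′) ≡ ((a + d) + a′) + ((b + e) + a′)
        regroup-uw = solve-∀
        regroup-uv : ∀ a b a′ b′ d e → ((a + b) + (a′ + b′)) + (d + e) ≡ ((a + d) + a′) + ((b + e) + b′)
        regroup-uv = solve-∀
        regroup-wz : ∀ a b a′ b′ d e → ((b + e) + a′) + ((a + d) + b′) ≡ ((a + b) + (a′ + b′)) + (d + e)
        regroup-wz = solve-∀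
        regroup-uv+2c : ∀ a b a′ b′ d e k →
                        ((a + b) + (a′ + b′)) + ((d + e) + k) ≡ (((a + d) + a′) + ((b + e) + b′)) + k
        regroup-uv+2c = solve-∀

    module OddCross (odd-ℓ₁ : Odd ℓ₁) (odd-ℓ₂ : Odd ℓ₂) (cross : parity l₁ ℙ.+ parity l₂ ≡ 1ℙ) where

      odd-arc : ∀ i j d → parity i ≡ parity l₁ → parity j ≡ parity l₂ → i + d ≡ j ⊎ j + d ≡ i → Odd d
      odd-arc i j d i∼l₁ j∼l₂ direction =
        trans (gap-parity-either {i} {d} {j} direction) (trans (cong₂ ℙ._+_ i∼l₁ j∼l₂) cross)

      separated : h₁ < l₂ → DivisibleCycle
      separated h₁<l₂
        with dLL , eLL , LL ← arc-up at-lo₁ at-lo₂ (<-trans l₁<h₁ h₁<l₂)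
        with dLH , eLH , LH ← arc-up at-lo₁ at-hi₂ (<-trans (<-trans l₁<h₁ h₁<l₂) l₂<h₂)
        with dHL , eHL , HL ← arc-up at-hi₁ at-lo₂ h₁<l₂
        with dHH , eHH , HH ← arc-up at-hi₁ at-hi₂ (<-trans h₁<l₂ l₂<h₂) =
        noncrossing-case odd-ℓ₁ odd-ℓ₂ {c = 0} LL LH HL HH
          (odd-arc l₁ l₂ dLL refl refl (inj₁ eLL)) (odd-arc h₁ l₂ dHL parity-h₁ refl (inj₁ eHL))
          (odd-arc h₁ h₂ dHH parity-h₁ parity-h₂ (inj₁ eHH))
          (trans (separated-gaps l₁ h₁ dLL dLH dHL dHH eLL eLH eHL eHH) (≡-sym (+-identityʳ _))) refl

      separated′ : h₂ < l₁ → DivisibleCycle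
      separated′ h₂<l₁
        with dLL , eLL , LL ← arc-down at-lo₁ at-lo₂ (<-trans l₂<h₂ h₂<l₁)
        with dLH , eLH , LH ← arc-down at-lo₁ at-hi₂ h₂<l₁
        with dHL , eHL , HL ← arc-down at-hi₁ at-lo₂ (<-trans (<-trans l₂<h₂ h₂<l₁) l₁<h₁)
        with dHH , eHH , HH ← arc-down at-hi₁ at-hi₂ (<-trans h₂<l₁ l₁<h₁) =
        noncrossing-case odd-ℓ₁ odd-ℓ₂ {c = 0} LL LH HL HH
          (odd-arc l₁ l₂ dLL refl refl (inj₂ eLL)) (odd-arc h₁ l₂ dHL parity-h₁ refl (inj₂ eHL))
          (odd-arc h₁ h₂ dHH parity-h₁ parity-h₂ (inj₂ eHH))
          (trans (+-comm dLH dHL)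
                 (trans (separated-gaps l₂ h₂ dLL dHL dLH dHH eLL eHL eLH eHH) (≡-sym (+-identityʳ _))))
          refl

      nested : l₁ < l₂ → h₂ < h₁ → DivisibleCycle
      nested l₁<l₂ h₂<h₁
        with dLL , eLL , LL ← arc-up at-lo₁ at-lo₂ l₁<l₂
        with dLH , eLH , LH ← arc-up at-lo₁ at-hi₂ (<-trans l₁<l₂ l₂<h₂)
        with dHL , eHL , HL ← arc-down at-hi₁ at-lo₂ (<-trans l₂<h₂ h₂<h₁)
        with dHH , eHH , HH ← arc-down at-hi₁ at-hi₂ h₂<h₁ =
        noncrossing-case odd-ℓ₁ odd-ℓ₂ {c = gap₂} LL LH HL HH
          (odd-arc l₁ l₂ dLL refl refl (inj₁ eLL)) (odd-arc h₁ l₂ dHL parity-h₁ refl (inj₂ eHL))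
          (odd-arc h₁ h₂ dHH parity-h₁ parity-h₂ (inj₂ eHH))
          (nested-gaps l₁ l₂ gap₂ dLL dLH dHL dHH l₂+gap₂≡h₂ eLL eLH eHL eHH) even-gap₂

      nested′ : l₂ < l₁ → h₁ < h₂ → DivisibleCycle
      nested′ l₂<l₁ h₁<h₂
        with dLL , eLL , LL ← arc-down at-lo₁ at-lo₂ l₂<l₁
        with dLH , eLH , LH ← arc-up at-lo₁ at-hi₂ (<-trans l₁<h₁ h₁<h₂)
        with dHL , eHL , HL ← arc-down at-hi₁ at-lo₂ (<-trans l₂<l₁ l₁<h₁)
        with dHH , eHH , HH ← arc-up at-hi₁ at-hi₂ h₁<h₂ =
        noncrossing-case odd-ℓ₁ odd-ℓ₂ {c = gap₁} LL LH HL HH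
          (odd-arc l₁ l₂ dLL refl refl (inj₂ eLL)) (odd-arc h₁ l₂ dHL parity-h₁ refl (inj₂ eHL))
          (odd-arc h₁ h₂ dHH parity-h₁ parity-h₂ (inj₁ eHH))
          (trans (+-comm dLH dHL) (nested-gaps l₂ l₁ gap₁ dLL dHL dLH dHH l₁+gap₁≡h₁ eLL eHL eLH eHH)) even-gap₁

      odd-cross-case : 4 ∣ M + 2 → DivisibleCycle
      odd-cross-case 4∣M+2 with <-cmp h₁ l₂
      ... | tri< h₁<l₂ _ _ = separated h₁<l₂
      ... | tri≈ _ h₁≡l₂ _ = ⊥-elim (positions-differ hi₁∈P₁ lo₂∈P₂ at-hi₁ at-lo₂ h₁≡l₂)
      ... | tri> _ _ l₂<h₁ with <-cmp h₂ l₁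
      ...   | tri< h₂<l₁ _ _ = separated′ h₂<l₁
      ...   | tri≈ _ h₂≡l₁ _ = ⊥-elim (positions-differ lo₁∈P₁ hi₂∈P₂ at-lo₁ at-hi₂ (≡-sym h₂≡l₁))
      ...   | tri> _ _ l₁<h₂ with <-cmp l₁ l₂ | <-cmp h₁ h₂
      ...     | tri< l₁<l₂ _ _ | tri< h₁<h₂ _ _ =
        Crossing.crossing-case B₁ B₂ P₁∩P₂≡∅ at-lo₁ at-lo₂ at-hi₁ at-hi₂ l₁<l₂ l₂<h₁ h₁<h₂
          odd-ℓ₁ odd-ℓ₂ cross parity-h₁ parity-h₂ 4∣M+2
      ...     | tri< l₁<l₂ _ _ | tri> _ _ h₂<h₁ = nested l₁<l₂ h₂<h₁
      ...     | tri> _ _ l₂<l₁ | tri< h₁<h₂ _ _ = nested′ l₂<l₁ h₁<h₂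
      ...     | tri> _ _ l₂<l₁ | tri> _ _ h₂<h₁ =
        Crossing.crossing-case B₂ B₁ (λ v v∈P₂ v∈P₁ → P₁∩P₂≡∅ v v∈P₁ v∈P₂)
          at-lo₂ at-lo₁ at-hi₂ at-hi₁ l₂<l₁ l₁<h₂ h₂<h₁
          odd-ℓ₂ odd-ℓ₁ (trans (ℙ+-comm (parity l₂) (parity l₁)) cross) parity-h₂ parity-h₁ 4∣M+2
      ...     | tri≈ _ l₁≡l₂ _ | _ = ⊥-elim (positions-differ lo₁∈P₁ lo₂∈P₂ at-lo₁ at-lo₂ l₁≡l₂)
      ...     | _ | tri≈ _ h₁≡h₂ _ = ⊥-elim (positions-differ hi₁∈P₁ hi₂∈P₂ at-hi₁ at-hi₂ h₁≡h₂)

lemma5 : ∀ {n : ℕ} (G : Graph n) (C P₁ P₂ D Q₁ Q₂ : List (Fin n)) (a₁ b₁ a₂ b₂ x y : Fin n)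
    → IsCycle G C → 2 ∣ length C
    → Bridge G C P₁ a₁ b₁ → Bridge G C P₂ a₂ b₂
    → (∀ v → v ∈ P₁ → v ∉ P₂)
    → EvenSpan C a₁ b₁ → EvenSpan C a₂ b₂
    → IsAdjustable G D Q₁ Q₂ x y
    → x ∈ P₁ → x ∉ C → y ∈ P₂ → y ∉ C
    → (∀ v → RVert D Q₁ Q₂ v → v ∈ P₁ ⊎ v ∈ P₂ → v ≡ x ⊎ v ≡ y)
    → (∀ v → RVert D Q₁ Q₂ v → v ∉ C)
    → ∃ λ (Z : List (Fin n)) → IsCycle G Z
        × (∀ u v → CEdge Z u v →
             CEdge C u v ⊎ PEdge P₁ u v ⊎ PEdge P₂ u v ⊎ REdge D Q₁ Q₂ u v)
        × 4 ∣ length Z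
lemma5 G C P₁ P₂ D Q₁ Q₂ a₁ b₁ a₂ b₂ x y C-cycle C-even bridge₁ bridge₂ P₁∩P₂≡∅ span₁ span₂ R-adjustable
       x∈P₁ x∉C y∈P₂ y∉C R∩P R∩C = by-cases (even⇒4∣n⊎4∣n+2 {length C} (2∣⇒even C-even))
  where
    open Configuration G C P₁ P₂ D Q₁ Q₂ a₁ b₁ a₂ b₂ x y C-cycle bridge₁ bridge₂ P₁∩P₂≡∅ R-adjustable
                       x∈P₁ x∉C y∈P₂ y∉C R∩P R∩C
    o₁ : OrientedBridge x P₁
    o₁ = orient (2∣⇒even C-even) span₁ (split-bridge bridge₁ (λ c → inj₂ (inj₁ (inj₁ c))) x∈P₁ x∉C)
    o₂ : OrientedBridge y P₂
    o₂ = orient (2∣⇒even C-even) span₂ (split-bridge bridge₂ (λ c → inj₂ (inj₂ (inj₁ (inj₁ c)))) y∈P₂ y∉C)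
    open TwoBridges o₁ o₂
    by-cases : 4 ∣ length C ⊎ 4 ∣ length C + 2 → DivisibleCycle
    by-cases (inj₁ 4∣C) = C , C-cycle , (λ _ _ → inj₁) , 4∣C
    by-cases (inj₂ 4∣C+2) with parity ℓ₁ in parity-ℓ₁ | parity ℓ₂ in parity-ℓ₂ | parity l₁ ℙ.+ parity l₂ in cross
    ... | 0ℙ | _  | _  = even-bridge-case o₁ parity-ℓ₁ 4∣C+2
    ... | 1ℙ | 0ℙ | _  = even-bridge-case o₂ parity-ℓ₂ 4∣C+2
    ... | 1ℙ | 1ℙ | 0ℙ = even-cross-case cross 4∣C+2
    ... | 1ℙ | 1ℙ | 1ℙ = OddCross.odd-cross-case parity-ℓ₁ parity-ℓ₂ cross 4∣C+2
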